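{- Let $k\ge2$ be an integer and let $G$ be a chordal graph with leafage at most $k$. Then $G$ is isomorphic to the intersection graph of a family $\{T_i\}$ of subtrees of a tree $T$ such that (1) $T$ has $k$ leaves and maximum degree $3$, and (2) no two subtrees $T_i$ and $T_j$ (with $i\neq j$) share a common leaf.
   Context: A chordal graph is the intersection graph of a finite family of subtrees of some tree (the ambient tree); the vertices correspond to the subtrees and two are adjacent iff the subtrees share a vertex. The leafage of a chordal graph $G$ is the minimum number of leaves of an ambient tree over all such representations of $G$. A leaf of a tree is a vertex of degree $1$. -}

module Defs where

open import Data.Nat using (ℕ; zero; suc; _+_; _≤_; _≡ᵇ_)
open import Data.Bool using (Bool; true; false; _∧_)
open import Data.Fin using (Fin; zero; suc; inject₁; fromℕ)
open import Data.List using (List; length; filterᵇ; allFin)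
open import Data.Product using (Σ; ∃; _×_; _,_)
open import Relation.Binary.PropositionalEquality using (_≡_; _≢_)
open import Relation.Nullary using (¬_)
open import Function.Definitions using (Injective)
open import Function.Bundles using (_⇔_)

record Graph (n : ℕ) : Set where
  field
    adj    : Fin n → Fin n → Bool
    sym    : ∀ u v → adj u v ≡ adj v u
    irrefl : ∀ v → adj v v ≡ false
open Graph public

VSet : ℕ → Set
VSet m = Fin m → Bool

count : ∀ {m} → (Fin m → Bool) → ℕ
count {m} p = length (filterᵇ p (allFin m))

degreeIn : ∀ {m} → Graph m → VSet m → Fin m → ℕ
degreeIn G S x = count (λ y → S y ∧ adj G x y)

degree : ∀ {m} → Graph m → Fin m → ℕ
degree G x = count (λ y → adj G x y)

data ReachIn {m} (G : Graph m) (S : VSet m) : Fin m → Fin m → Set where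
  here : ∀ {u} → S u ≡ true → ReachIn G S u u
  step : ∀ {u v w} → S u ≡ true → adj G u v ≡ true → ReachIn G S v w → ReachIn G S u w

HasCycle : ∀ {m} → Graph m → Set
HasCycle {m} G =
  Σ ℕ λ l → Σ (Fin (suc (suc (suc l))) → Fin m) λ c →
    Injective _≡_ _≡_ c
    × (∀ (i : Fin (suc (suc l))) → adj G (c (inject₁ i)) (c (suc i)) ≡ true)
    × adj G (c (fromℕ (suc (suc l)))) (c zero) ≡ true

IsTree : ∀ {m} → Graph m → Set
IsTree {m} G = (1 ≤ m) × (∀ u v → ReachIn G (λ _ → true) u v) × ¬ HasCycle G

IsSubtree : ∀ {m} → Graph m → VSet m → Set
IsSubtree G S = (∃ λ x → S x ≡ true)
              × (∀ u v → S u ≡ true → S v ≡ true → ReachIn G S u v)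

numLeaves : ∀ {m} → Graph m → ℕ
numLeaves G = count (λ x → degree G x ≡ᵇ 1)

IsLeafOf : ∀ {m} → Graph m → VSet m → Fin m → Set
IsLeafOf G S x = (S x ≡ true) × (degreeIn G S x ≡ 1)

-- G (on Fin n) is isomorphic to the intersection graph of the family Sub indexed by V(G),
-- i.e. a subtree model of G in the tree T.
record SubtreeModel {n m} (G : Graph n) (T : Graph m) : Set where
  field
    Sub       : Fin n → VSet m
    subtree   : ∀ i → IsSubtree T (Sub i)
    intersect : ∀ i j → i ≢ j → (adj G i j ≡ true ⇔ (∃ λ x → Sub i x ≡ true × Sub j x ≡ true))
open SubtreeModel public

Chordal : ∀ {n} → Graph n → Set
Chordal G = Σ ℕ λ m → Σ (Graph m) λ T → IsTree T × SubtreeModel G T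

LeafageAtMost : ∀ {n} → Graph n → ℕ → Set
LeafageAtMost G k = Σ ℕ λ m → Σ (Graph m) λ T → IsTree T × SubtreeModel G T × numLeaves T ≤ k

module Submission where

-- Root a tree model of G with at most k leaves at one of its leaves r.  Every vertex x of the
-- model becomes a node V x, and its children are attached one by one along a chain of hub nodes
-- starting at a node Z x, so no node has more than three neighbours and Z x is a leaf exactly
-- when x has no children.  A new leaf above r and a spine carrying the missing leaves bring the
-- number of leaves to exactly k.  Finally every edge is subdivided into 2n + 1 points: the image
-- of the i-th subtree covers an edge completely when it contains both ends, and otherwise stops
-- at point i coming from above or at point n + i coming from below.  All leaves of the images are
-- such stopping points, so images of different subtrees never share a leaf.

open import Defs hiding (sym)
open import Data.Bool using (Bool; true; false; _∧_; _∨_; not; if_then_else_)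
open import Data.Bool.Properties using (∧-conicalˡ; ∧-conicalʳ)
open import Data.Empty using (⊥-elim)
open import Data.Fin as Fin using (Fin; zero; suc; toℕ; _↑ˡ_; _↑ʳ_; inject₁; fromℕ; fromℕ<; lower₁)
open import Data.Fin.Properties
  using (+↔⊎; *↔×; 1↔⊤; toℕ<n; toℕ-injective; toℕ-inject₁; toℕ-fromℕ; toℕ-fromℕ<; toℕ-lower₁; inject₁-lower₁;
         toℕ-inject₁-≢; lower₁-inject₁′)
open import Data.List using (List; length; filterᵇ; tabulate; allFin; filter)
open import Data.List.Extrema.Nat using (argmin; argmax; argmin-all; f[argmin]≤f[xs]; f[xs]≤f[argmax])
open import Data.List.Membership.Propositional.Properties using (∈-allFin; ∈-filter⁺)
open import Data.List.Relation.Unary.All as All using ()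
open import Data.List.Relation.Unary.All.Properties using (all-filter)
open import Data.Maybe using (Maybe; just; nothing; maybe)
open import Data.Nat as ℕ using (ℕ; zero; suc; _+_; _*_; _∸_; _≤_; _<_; z≤n; s≤s; _≡ᵇ_; _≤?_; >-nonZero⁻¹)
open import Data.Nat.Properties hiding (_≟_)
open import Algebra.Properties.CommutativeSemigroup +-commutativeSemigroup using (interchange)
open import Data.Product using (Σ; ∃; _×_; _,_; proj₁; proj₂)
open import Data.Product.Function.NonDependent.Propositional using (_×-cong_)
open import Data.Sum using (_⊎_; inj₁; inj₂)
open import Data.Sum.Function.Propositional using (_⊎-cong_)
open import Data.Unit using (⊤; tt)
open import Function using (_∘_)
open import Function.Bundles using (_↔_; Inverse; _⇔_; mk⇔)
open import Function.Construct.Composition using (_⇔-∘_)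
open import Function.Properties.Inverse using (↔-refl; ↔-trans)
open import Relation.Binary.Definitions using (tri<; tri≈; tri>)
open import Relation.Binary.PropositionalEquality
  using (_≡_; _≢_; refl; sym; trans; cong; cong₂; subst; subst₂; module ≡-Reasoning)
open import Relation.Nullary using (Dec; does; yes; no; ¬_; _×-dec_)
open import Relation.Nullary.Decidable using (map′; dec-true; dec-false; ¬?)
import Data.Bool.Properties as Boolₚ
import Data.Fin.Properties as Finₚ
import Data.Sum as Sum

does-true : ∀ {A : Set} {a? : Dec A} → does a? ≡ true → A
does-true {a? = yes a} _ = a
does-true {a? = no _} ()

not-does : ∀ {A : Set} {a? : Dec A} → not (does a?) ≡ true → ¬ A
not-does {a? = no ¬a} _ = ¬a

∧-intro : ∀ {a b} → a ≡ true → b ≡ true → (a ∧ b) ≡ true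
∧-intro refl refl = refl

∧-elim : ∀ a {b} → (a ∧ b) ≡ true → a ≡ true × b ≡ true
∧-elim a e = ∧-conicalˡ a _ e , ∧-conicalʳ a _ e

-- Counting and searching in Fin n

bit : Bool → ℕ
bit true  = 1
bit false = 0

cnt : ∀ {n} → (Fin n → Bool) → ℕ
cnt {zero}  p = 0
cnt {suc n} p = bit (p zero) + cnt (p ∘ suc)

length-filter-tabulate : ∀ {A : Set} {n} (p : A → Bool) (f : Fin n → A) →
                         length (filterᵇ p (tabulate f)) ≡ cnt (p ∘ f)
length-filter-tabulate {n = zero}  p f = refl
length-filter-tabulate {n = suc n} p f with p (f zero)
... | true  = cong suc (length-filter-tabulate p (f ∘ suc))
... | false = length-filter-tabulate p (f ∘ suc)

count≡cnt : ∀ {n} (p : Fin n → Bool) → count p ≡ cnt p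
count≡cnt p = length-filter-tabulate p (λ i → i)

cnt-cong : ∀ {n} {p q : Fin n → Bool} → (∀ i → p i ≡ q i) → cnt p ≡ cnt q
cnt-cong {zero}  e = refl
cnt-cong {suc n} e = cong₂ _+_ (cong bit (e zero)) (cnt-cong (e ∘ suc))

bit-mono : ∀ {a b} → (a ≡ true → b ≡ true) → bit a ≤ bit b
bit-mono {true}  h rewrite h refl = ≤-refl
bit-mono {false} h = z≤n

cnt-mono : ∀ {n} {p q : Fin n → Bool} → (∀ i → p i ≡ true → q i ≡ true) → cnt p ≤ cnt q
cnt-mono {zero}  h = z≤n
cnt-mono {suc n} h = +-mono-≤ (bit-mono (h zero)) (cnt-mono (h ∘ suc))

cnt-const-false : ∀ n → cnt {n} (λ _ → false) ≡ 0
cnt-const-false zero    = refl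
cnt-const-false (suc n) = cnt-const-false n

cnt-const-true : ∀ n → cnt {n} (λ _ → true) ≡ n
cnt-const-true zero    = refl
cnt-const-true (suc n) = cong suc (cnt-const-true n)

cnt≤size : ∀ {n} (p : Fin n → Bool) → cnt p ≤ n
cnt≤size {n} p = ≤-trans (cnt-mono {n} {p} {λ _ → true} (λ _ _ → refl)) (≤-reflexive (cnt-const-true n))

1≤cnt : ∀ {n} {p : Fin n → Bool} i → p i ≡ true → 1 ≤ cnt p
1≤cnt {p = p} zero    pi rewrite pi = s≤s z≤n
1≤cnt {p = p} (suc i) pi = ≤-trans (1≤cnt {p = p ∘ suc} i pi) (m≤n+m _ (bit (p zero)))

2≤cnt : ∀ {n} {p : Fin n → Bool} i j → i ≢ j → p i ≡ true → p j ≡ true → 2 ≤ cnt p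
2≤cnt         zero    zero    i≢j _  _  = ⊥-elim (i≢j refl)
2≤cnt {p = p} zero    (suc j) _   pi pj rewrite pi = s≤s (1≤cnt {p = p ∘ suc} j pj)
2≤cnt {p = p} (suc i) zero    _   pi pj rewrite pj = s≤s (1≤cnt {p = p ∘ suc} i pi)
2≤cnt {p = p} (suc i) (suc j) i≢j pi pj =
  ≤-trans (2≤cnt {p = p ∘ suc} i j (i≢j ∘ cong suc) pi pj) (m≤n+m _ (bit (p zero)))

cnt-witness : ∀ {n} (p : Fin n → Bool) → 1 ≤ cnt p → ∃ λ i → p i ≡ true
cnt-witness {suc n} p 1≤ with p zero in p0
... | true  = zero , p0
... | false with cnt-witness (p ∘ suc) 1≤
...   | i , pi = suc i , pi

bit-∨ : ∀ a b → bit (a ∨ b) ≤ bit a + bit b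
bit-∨ true  b = s≤s z≤n
bit-∨ false b = ≤-refl

cnt-∨ : ∀ {n} (p q : Fin n → Bool) → cnt (λ i → p i ∨ q i) ≤ cnt p + cnt q
cnt-∨ {zero}  p q = z≤n
cnt-∨ {suc n} p q = ≤-trans (+-mono-≤ (bit-∨ (p zero) (q zero)) (cnt-∨ (p ∘ suc) (q ∘ suc)))
                            (≤-reflexive (interchange (bit (p zero)) (bit (q zero)) _ _))

cnt-∨-disjoint : ∀ {n} (p q : Fin n → Bool) → (∀ i → p i ≡ true → q i ≡ false) →
                 cnt (λ i → p i ∨ q i) ≡ cnt p + cnt q
cnt-∨-disjoint {zero}  p q _ = refl
cnt-∨-disjoint {suc n} p q disj = trans
  (cong₂ _+_ (bit-disjoint (p zero) (q zero) (disj zero)) (cnt-∨-disjoint (p ∘ suc) (q ∘ suc) (disj ∘ suc)))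
  (interchange (bit (p zero)) (bit (q zero)) _ _)
  where
  bit-disjoint : ∀ a b → (a ≡ true → b ≡ false) → bit (a ∨ b) ≡ bit a + bit b
  bit-disjoint true  b h rewrite h refl = refl
  bit-disjoint false b h = refl

cnt-+ : ∀ a {b} (p : Fin (a + b) → Bool) → cnt p ≡ cnt (λ i → p (i ↑ˡ b)) + cnt (λ j → p (a ↑ʳ j))
cnt-+ zero    p = refl
cnt-+ (suc a) p = trans (cong (bit (p zero) +_) (cnt-+ a (p ∘ suc))) (sym (+-assoc (bit (p zero)) _ _))

cnt-≤1 : ∀ {n} {p : Fin n → Bool} → (∀ i j → p i ≡ true → p j ≡ true → i ≡ j) → cnt p ≤ 1
cnt-≤1 {zero}          _    = z≤n
cnt-≤1 {suc n} {p} uniq with p zero in p0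
... | true  = ≤-reflexive (cong suc (trans (cnt-cong rest-false) (cnt-const-false n)))
  where
  rest-false : ∀ i → p (suc i) ≡ false
  rest-false i with p (suc i) in pi
  ... | true  with () ← uniq zero (suc i) p0 pi
  ... | false = refl
... | false = cnt-≤1 (λ i j pi pj → Finₚ.suc-injective (uniq (suc i) (suc j) pi pj))

cnt≡1 : ∀ {n} {p : Fin n → Bool} a → p a ≡ true → (∀ i → p i ≡ true → i ≡ a) → cnt p ≡ 1
cnt≡1 a pa uniq = ≤-antisym (cnt-≤1 (λ i j pi pj → trans (uniq i pi) (sym (uniq j pj)))) (1≤cnt a pa)

cnt-≤2 : ∀ {n} {p : Fin n → Bool} c → (∀ i j → p i ≡ true → p j ≡ true → i ≢ c → j ≢ c → i ≡ j) → cnt p ≤ 2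
cnt-≤2 {n} {p} c uniq = begin
  cnt p                             ≤⟨ cnt-mono split ⟩
  cnt (λ i → is-c i ∨ other i)      ≤⟨ cnt-∨ is-c other ⟩
  cnt is-c + cnt other              ≤⟨ +-mono-≤ (cnt-≤1 same-c) (cnt-≤1 same-other) ⟩
  2                                 ∎
  where
  open ≤-Reasoning
  is-c other : Fin n → Bool
  is-c i  = does (i Fin.≟ c)
  other i = not (is-c i) ∧ p i
  split : ∀ i → p i ≡ true → (is-c i ∨ other i) ≡ true
  split i pi with i Fin.≟ c
  ... | yes _ = refl
  ... | no  _ = pi
  same-c : ∀ i j → is-c i ≡ true → is-c j ≡ true → i ≡ j
  same-c i j ci cj with i Fin.≟ c | j Fin.≟ c
  ... | yes i≡c | yes j≡c = trans i≡c (sym j≡c)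
  same-other : ∀ i j → other i ≡ true → other j ≡ true → i ≡ j
  same-other i j oi oj with i Fin.≟ c | j Fin.≟ c
  ... | no i≢c | no j≢c = uniq i j oi oj i≢c j≢c

anyᵇ : ∀ {n} → (Fin n → Bool) → Bool
anyᵇ {zero}  p = false
anyᵇ {suc n} p = p zero ∨ anyᵇ (p ∘ suc)

anyᵇ-witness : ∀ {n} (p : Fin n → Bool) → anyᵇ p ≡ true → ∃ λ i → p i ≡ true
anyᵇ-witness {suc n} p any-p with p zero in p0
... | true  = zero , p0
... | false with anyᵇ-witness (p ∘ suc) any-p
...   | i , pi = suc i , pi

anyᵇ-intro : ∀ {n} (p : Fin n → Bool) i → p i ≡ true → anyᵇ p ≡ true
anyᵇ-intro p zero    pi rewrite pi = refl
anyᵇ-intro p (suc i) pi = trans (cong (p zero ∨_) (anyᵇ-intro (p ∘ suc) i pi)) (Boolₚ.∨-zeroʳ (p zero))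

IsLast : ∀ {n} → (Fin n → Bool) → Maybe (Fin n) → Set
IsLast p nothing  = ∀ i → p i ≡ false
IsLast p (just i) = p i ≡ true × (∀ j → i Fin.< j → p j ≡ false)

last : ∀ {n} → (Fin n → Bool) → Maybe (Fin n)
last {zero}  p = nothing
last {suc n} p with last (p ∘ suc)
... | just i  = just (suc i)
... | nothing = if p zero then just zero else nothing

last-correct : ∀ {n} (p : Fin n → Bool) → IsLast p (last p)
last-correct {zero}  p = λ ()
last-correct {suc n} p with last (p ∘ suc) | last-correct (p ∘ suc)
... | just i  | pi , after-i = pi , λ { (suc j) (s≤s i<j) → after-i j i<j }
... | nothing | none with p zero in p0
...   | true  = p0 , λ { (suc j) _ → none j }
...   | false = λ { zero → p0 ; (suc j) → none j }

opaque
  minimiser : ∀ {n} (f : Fin n → ℕ) (p : Fin n → Bool) {i} → p i ≡ true →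
              Σ (Fin n) λ t → p t ≡ true × (∀ j → p j ≡ true → f t ≤ f j)
  minimiser {n} f p {i} pi = t , argmin-all f pi (all-filter P? (allFin n)) , minimal
    where
    P? : (j : Fin n) → Dec (p j ≡ true)
    P? j = p j Boolₚ.≟ true
    candidates : List (Fin n)
    candidates = filter P? (allFin n)
    t : Fin n
    t = argmin f i candidates
    minimal : ∀ j → p j ≡ true → f t ≤ f j
    minimal j pj = All.lookup (f[argmin]≤f[xs] i candidates) (∈-filter⁺ P? (∈-allFin j) pj)

  maximiser : ∀ {n} (f : Fin (suc n) → ℕ) → Σ (Fin (suc n)) λ t → ∀ j → f j ≤ f t
  maximiser {n} f = t , λ j → All.lookup (f[xs]≤f[argmax] {f = f} zero (allFin (suc n))) (∈-allFin j)
    where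
    t : Fin (suc n)
    t = argmax f zero (allFin (suc n))

least-ℕ : (p : ℕ → Bool) {n : ℕ} → p n ≡ true → Σ ℕ λ t → p t ≡ true × (∀ s → p s ≡ true → t ≤ s)
least-ℕ p {n} pn with minimiser toℕ (p ∘ toℕ) {fromℕ n} (subst (λ k → p k ≡ true) (sym (toℕ-fromℕ n)) pn)
... | t , pt , minimal = toℕ t , pt , below
  where
  below : ∀ s → p s ≡ true → toℕ t ≤ s
  below s ps with s ≤? n
  ... | yes s≤n = subst (toℕ t ≤_) (toℕ-fromℕ< (s≤s s≤n))
                    (minimal (fromℕ< (s≤s s≤n)) (subst (λ k → p k ≡ true) (sym (toℕ-fromℕ< (s≤s s≤n))) ps))
  ... | no  s≰n = ≤-trans (≤-pred (toℕ<n t)) (<⇒≤ (≰⇒> s≰n))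

cnt-⊎ : ∀ {a b} {A B : Set} (e₁ : Fin a ↔ A) (e₂ : Fin b ↔ B) (P : A ⊎ B → Bool) →
        cnt (P ∘ Inverse.to (↔-trans +↔⊎ (e₁ ⊎-cong e₂))) ≡
        cnt (P ∘ inj₁ ∘ Inverse.to e₁) + cnt (P ∘ inj₂ ∘ Inverse.to e₂)
cnt-⊎ {a} {b} e₁ e₂ P = trans (cnt-+ a _) (cong₂ _+_ (cnt-cong left) (cnt-cong right))
  where
  left : ∀ i → P (Sum.map (Inverse.to e₁) (Inverse.to e₂) (Fin.splitAt a (i ↑ˡ b))) ≡ P (inj₁ (Inverse.to e₁ i))
  left i rewrite Finₚ.splitAt-↑ˡ a i b = refl
  right : ∀ j → P (Sum.map (Inverse.to e₁) (Inverse.to e₂) (Fin.splitAt a (a ↑ʳ j))) ≡ P (inj₂ (Inverse.to e₂ j))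
  right j rewrite Finₚ.splitAt-↑ʳ a b j = refl

-- Walks and cycles

no-loop : ∀ {m} (G : Graph m) {v} → adj G v v ≢ true
no-loop G {v} loop with () ← trans (sym loop) (Graph.irrefl G v)

adj-sym : ∀ {m} {G : Graph m} {u v} → adj G u v ≡ true → adj G v u ≡ true
adj-sym {G = G} {u} {v} uv = trans (Graph.sym G v u) uv

module _ {m} {G : Graph m} {S : VSet m} where

  reach-start : ∀ {u v} → ReachIn G S u v → S u ≡ true
  reach-start (here su)     = su
  reach-start (step su _ _) = su

  reach-trans : ∀ {u v w} → ReachIn G S u v → ReachIn G S v w → ReachIn G S u w
  reach-trans (here _)          q = q
  reach-trans (step su uv rest) q = step su uv (reach-trans rest q)

  reach-snoc : ∀ {u v w} → ReachIn G S u v → adj G v w ≡ true → S w ≡ true → ReachIn G S u w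
  reach-snoc (here sv)         vw sw = step sv vw (here sw)
  reach-snoc (step su uv rest) vw sw = step su uv (reach-snoc rest vw sw)

  reach-sym : ∀ {u v} → ReachIn G S u v → ReachIn G S v u
  reach-sym (here su) = here su
  reach-sym (step su uv rest) = reach-snoc (reach-sym rest) (adj-sym {G = G} uv) su

record NonBacktrackingWalk {m} (G : Graph m) (L : ℕ) : Set where
  field
    vertex       : ℕ → Fin m
    along-edges  : ∀ t → t < L → adj G (vertex t) (vertex (suc t)) ≡ true
    no-backtrack : ∀ t → suc (suc t) ≤ L → vertex (suc (suc t)) ≢ vertex t

module _ {m} {G : Graph m} {L} (W : NonBacktrackingWalk G L) where
  open NonBacktrackingWalk W renaming (vertex to w)

  repeats : ℕ → Bool
  repeats j = anyᵇ (λ (i : Fin j) → does (w (toℕ i) Fin.≟ w j))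

  repeats-intro : ∀ {i j} → i < j → w i ≡ w j → repeats j ≡ true
  repeats-intro {i} {j} i<j wi≡wj =
    anyᵇ-intro _ (fromℕ< i<j) (dec-true (_ Fin.≟ _) (trans (cong w (toℕ-fromℕ< i<j)) wi≡wj))

  repeats-witness : ∀ j → repeats j ≡ true → ∃ λ i → i < j × w i ≡ w j
  repeats-witness j rep with anyᵇ-witness _ rep
  ... | i , eq = toℕ i , toℕ<n i , does-true {a? = w (toℕ i) Fin.≟ w j} eq

  segment⇒cycle : ∀ i l → let j = i + suc (suc (suc l)) in
                  j ≤ L → (∀ s s′ → s < s′ → s′ < j → w s ≢ w s′) → w i ≡ w j → HasCycle G
  segment⇒cycle i l j≤L distinct wi≡wj = l , c , injective , edges , closing
    where
    c : Fin (suc (suc (suc l))) → Fin m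
    c k = w (i + toℕ k)
    inside : ∀ (k : Fin (suc (suc (suc l)))) → i + toℕ k < i + suc (suc (suc l))
    inside k = +-monoʳ-< i (toℕ<n k)
    injective : ∀ {k k′} → c k ≡ c k′ → k ≡ k′
    injective {k} {k′} eq with <-cmp (toℕ k) (toℕ k′)
    ... | tri< k<k′ _ _ = ⊥-elim (distinct _ _ (+-monoʳ-< i k<k′) (inside k′) eq)
    ... | tri≈ _ k≡k′ _ = toℕ-injective k≡k′
    ... | tri> _ _ k′<k = ⊥-elim (distinct _ _ (+-monoʳ-< i k′<k) (inside k) (sym eq))
    edges : ∀ (k : Fin (suc (suc l))) → adj G (c (inject₁ k)) (c (suc k)) ≡ true
    edges k rewrite toℕ-inject₁ k | +-suc i (toℕ k) =
      along-edges (i + toℕ k) (≤-trans (≤-trans (≤-reflexive (sym (+-suc i (toℕ k)))) (<⇒≤ (inside (suc k)))) j≤L)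
    last-step : suc (i + suc (suc l)) ≡ i + suc (suc (suc l))
    last-step = sym (+-suc i (suc (suc l)))
    closing : adj G (c (fromℕ (suc (suc l)))) (c zero) ≡ true
    closing rewrite toℕ-fromℕ (suc (suc l)) | +-identityʳ i =
      subst (λ v → adj G (w (i + suc (suc l))) v ≡ true) (trans (cong w last-step) (sym wi≡wj))
            (along-edges (i + suc (suc l)) (≤-trans (≤-reflexive last-step) j≤L))

  -- The first repetition closes a cycle of distinct vertices; it has length ≥ 3
  -- because G is loopless and the walk does not backtrack.
  closed⇒cycle : 0 < L → w 0 ≡ w L → HasCycle G
  closed⇒cycle 0<L closed with least-ℕ repeats {L} (repeats-intro 0<L closed)
  ... | j , rep-j , first-rep with repeats-witness j rep-j
  ... | i , i<j , wi≡wj = cycle-with-gap (j ∸ i) (sym (m+[n∸m]≡n (<⇒≤ i<j)))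
    where
    j≤L : j ≤ L
    j≤L = first-rep L (repeats-intro 0<L closed)
    distinct : ∀ s s′ → s < s′ → s′ < j → w s ≢ w s′
    distinct s s′ s<s′ s′<j ws≡ws′ = <⇒≱ s′<j (first-rep s′ (repeats-intro s<s′ ws≡ws′))
    cycle-with-gap : ∀ g → j ≡ i + g → HasCycle G
    cycle-with-gap zero j≡i+0 = ⊥-elim (<-irrefl (sym (trans j≡i+0 (+-identityʳ i))) i<j)
    cycle-with-gap (suc zero) refl =
      ⊥-elim (no-loop G (subst (λ v → adj G (w i) v ≡ true) (trans (cong w (+-comm 1 i)) (sym wi≡wj))
                               (along-edges i (≤-trans (≤-reflexive (+-comm 1 i)) j≤L))))
    cycle-with-gap (suc (suc zero)) refl =
      ⊥-elim (no-backtrack i (≤-trans (≤-reflexive (+-comm 2 i)) j≤L) (trans (cong w (+-comm 2 i)) (sym wi≡wj)))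
    cycle-with-gap (suc (suc (suc l))) refl = segment⇒cycle i l j≤L distinct wi≡wj

module _ {m} {G : Graph m} where

  cycle-neighbours : ∀ l (c : Fin (suc (suc (suc l))) → Fin m) →
    (∀ (i : Fin (suc (suc l))) → adj G (c (inject₁ i)) (c (suc i)) ≡ true) →
    adj G (c (fromℕ (suc (suc l)))) (c zero) ≡ true →
    ∀ j → ∃ λ j⁺ → ∃ λ j⁻ → j⁺ ≢ j⁻ × adj G (c j) (c j⁺) ≡ true × adj G (c j) (c j⁻) ≡ true
  cycle-neighbours l c edge closing zero =
    suc zero , fromℕ (suc (suc l)) , (λ ()) , edge zero , adj-sym {G = G} closing
  cycle-neighbours l c edge closing (suc i) with suc l ℕ.≟ toℕ i
  ... | yes last =
    zero , inject₁ i , zero≢ , subst (λ k → adj G (c k) (c zero) ≡ true) (sym is-last) closing , adj-sym {G = G} (edge i)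
    where
    is-last : suc i ≡ fromℕ (suc (suc l))
    is-last = toℕ-injective (trans (cong suc (sym last)) (sym (toℕ-fromℕ (suc (suc l)))))
    zero≢ : zero ≢ inject₁ i
    zero≢ eq with () ← trans (cong toℕ eq) (trans (toℕ-inject₁ i) (sym last))
  ... | no not-last =
    suc k , inject₁ i , suc-k≢ , subst (λ x → adj G (c x) (c (suc k)) ≡ true) inject-k (edge k) , adj-sym {G = G} (edge i)
    where
    k : Fin (suc (suc l))
    k = suc (lower₁ i not-last)
    inject-k : inject₁ k ≡ suc i
    inject-k = cong suc (inject₁-lower₁ i not-last)
    suc-k≢ : suc k ≢ inject₁ i
    suc-k≢ eq = <⇒≢ (m≤n⇒m≤1+n (n<1+n (toℕ i)))
                    (sym (trans (cong (λ x → ℕ.suc (ℕ.suc x)) (sym (toℕ-lower₁ i not-last)))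
                                (trans (cong toℕ eq) (toℕ-inject₁ i))))

-- The tree on the nodes A (numbered by Fin N) in which every node but the root
-- is joined to its parent; the height witnesses that the parent map has no cycles.
module ParentTree {N : ℕ} {A : Set} (nodes : Fin N ↔ A)
                  (parent : A → A) (root : A) (height : A → ℕ)
                  (height-parent : ∀ a → a ≢ root → height (parent a) < height a) where

  open Inverse nodes public using ()
    renaming (to to node; from to code; strictlyInverseˡ to node-code; strictlyInverseʳ to code-node)

  code-injective : ∀ {a b} → code a ≡ code b → a ≡ b
  code-injective {a} {b} eq = trans (sym (node-code a)) (trans (cong node eq) (node-code b))

  _≟_ : (a b : A) → Dec (a ≡ b)
  a ≟ b = map′ code-injective (cong code) (code a Fin.≟ code b)

  parent-edge : A → A → Bool
  parent-edge a b = not (does (a ≟ root)) ∧ does (parent a ≟ b)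

  parent-edge⇒ : ∀ {a b} → parent-edge a b ≡ true → a ≢ root × parent a ≡ b
  parent-edge⇒ {a} {b} e =
    not-does {a? = a ≟ root} (∧-conicalˡ _ _ e) , does-true {a? = parent a ≟ b} (∧-conicalʳ _ _ e)

  parent-edge-intro : ∀ {a} → a ≢ root → parent-edge a (parent a) ≡ true
  parent-edge-intro {a} a≢root rewrite dec-false (a ≟ root) a≢root | dec-true (parent a ≟ parent a) refl = refl

  adjacentᵇ : A → A → Bool
  adjacentᵇ a b = parent-edge a b ∨ parent-edge b a

  tree : Graph N
  tree = record
    { adj    = λ x y → adjacentᵇ (node x) (node y)
    ; sym    = λ x y → Boolₚ.∨-comm (parent-edge (node x) (node y)) _
    ; irrefl = λ x → no-self-edge (node x)
    }
    where
    no-self-edge : ∀ a → adjacentᵇ a a ≡ false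
    no-self-edge a with parent-edge a a in e
    ... | false = refl
    ... | true  = ⊥-elim (<-irrefl (cong height (proj₂ (parent-edge⇒ e))) (height-parent a (proj₁ (parent-edge⇒ e))))

  Adjacent : A → A → Set
  Adjacent a b = adj tree (code a) (code b) ≡ true

  adjacent-parent : ∀ {a} → a ≢ root → Adjacent a (parent a)
  adjacent-parent {a} a≢root rewrite node-code a | node-code (parent a) | parent-edge-intro a≢root = refl

  adjacent-child : ∀ {b} → b ≢ root → Adjacent (parent b) b
  adjacent-child {b} b≢root = adj-sym {G = tree} (adjacent-parent b≢root)

  parent≢child : ∀ {a c} → a ≢ root → c ≢ root → parent c ≡ a → parent a ≢ c
  parent≢child {a} {c} a≢root c≢root pc≡a pa≡c =
    <-irrefl refl (<-trans (subst (λ x → height x < height a) pa≡c (height-parent a a≢root))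
                           (subst (λ x → height x < height c) pc≡a (height-parent c c≢root)))

  node-injective : ∀ {x y} → node x ≡ node y → x ≡ y
  node-injective {x} {y} eq = trans (sym (code-node x)) (trans (cong code eq) (code-node y))

  adj⇒ : ∀ {x y} → adj tree x y ≡ true →
         (node x ≢ root × parent (node x) ≡ node y) ⊎ (node y ≢ root × parent (node y) ≡ node x)
  adj⇒ {x} {y} xy with parent-edge (node x) (node y) in e
  ... | true  = inj₁ (parent-edge⇒ e)
  ... | false = inj₂ (parent-edge⇒ xy)

  Adjacent⇒ : ∀ {a b} → Adjacent a b → (a ≢ root × parent a ≡ b) ⊎ (b ≢ root × parent b ≡ a)
  Adjacent⇒ {a} {b} ab =
    subst₂ (λ x y → (x ≢ root × parent x ≡ y) ⊎ (y ≢ root × parent y ≡ x)) (node-code a) (node-code b) (adj⇒ ab)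

  member-code : (S : A → Bool) {a : A} → S a ≡ true → S (node (code a)) ≡ true
  member-code S {a} sa = trans (cong S (node-code a)) sa

  climb : (S : A → Bool) (t : A) → (∀ a → S a ≡ true → a ≢ t → a ≢ root × S (parent a) ≡ true) →
          ∀ k a → height a ≤ k → S a ≡ true → ReachIn tree (S ∘ node) (code a) (code t)
  climb S t closed k a a≤k sa with a ≟ t
  ... | yes refl = here (member-code S sa)
  ... | no a≢t with closed a sa a≢t | k
  ...   | a≢root , spa | zero  = ⊥-elim (n≮0 (≤-trans (height-parent a a≢root) a≤k))
  ...   | a≢root , spa | suc k =
    step (member-code S sa) (adjacent-parent a≢root)
         (climb S t closed k (parent a) (≤-pred (≤-trans (height-parent a a≢root) a≤k)) spa)

  closed⇒subtree : (S : A → Bool) (t : A) → S t ≡ true →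
                   (∀ a → S a ≡ true → a ≢ t → a ≢ root × S (parent a) ≡ true) → IsSubtree tree (S ∘ node)
  closed⇒subtree S t st closed =
    (code t , member-code S st) , λ u v su sv → reach-trans (up u su) (reach-sym (up v sv))
    where
    up : ∀ x → S (node x) ≡ true → ReachIn tree (S ∘ node) x (code t)
    up x sx = subst (λ y → ReachIn tree (S ∘ node) y (code t)) (code-node x) (climb S t closed _ (node x) ≤-refl sx)

  -- A highest vertex of a cycle could only be adjacent to its parent, yet it has two different
  -- neighbours on the cycle.
  acyclic : ¬ HasCycle tree
  acyclic (l , c , injective , edge , closing) with maximiser (height ∘ node ∘ c)
  ... | j , highest with cycle-neighbours {G = tree} l c edge closing j
  ... | j⁺ , j⁻ , j⁺≢j⁻ , to-j⁺ , to-j⁻ = j⁺≢j⁻ (injective (trans (to-parent j⁺ to-j⁺) (sym (to-parent j⁻ to-j⁻))))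
    where
    to-parent : ∀ k → adj tree (c j) (c k) ≡ true → c k ≡ code (parent (node (c j)))
    to-parent k jk with adj⇒ jk
    ... | inj₁ (_ , pj≡k) = trans (sym (code-node (c k))) (cong code (sym pj≡k))
    ... | inj₂ (k≢root , pk≡j) = ⊥-elim (<-irrefl refl (≤-trans (subst (λ x → height x < height (node (c k))) pk≡j
                                                                 (height-parent _ k≢root)) (highest k)))

  isTree : IsTree tree
  isTree = >-nonZero⁻¹ N {{Finₚ.nonZeroIndex (code root)}} , connected , acyclic
    where
    connected : ∀ x y → ReachIn tree (λ _ → true) x y
    connected x y = proj₂ (closed⇒subtree (λ _ → true) root refl (λ a _ a≢root → a≢root , refl)) x y refl refl

  Child : A → A → Set
  Child b a = b ≢ root × parent b ≡ a

  degree≤3 : ∀ a c → (∀ b b′ → Child b a → Child b′ a → b ≢ c → b′ ≢ c → b ≡ b′) → degree tree (code a) ≤ 3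
  degree≤3 a c children≤2 = begin
    degree tree (code a)                                                  ≡⟨ count≡cnt (adj tree (code a)) ⟩
    cnt (λ y → adjacentᵇ (node (code a)) (node y))
      ≡⟨ cnt-cong (λ y → cong (λ x → adjacentᵇ x (node y)) (node-code a)) ⟩
    cnt (λ y → parent-edge a (node y) ∨ parent-edge (node y) a)
      ≤⟨ cnt-∨ (λ y → parent-edge a (node y)) (λ y → parent-edge (node y) a) ⟩
    cnt (λ y → parent-edge a (node y)) + cnt (λ y → parent-edge (node y) a)
      ≤⟨ +-mono-≤ (cnt-≤1 one-parent) (cnt-≤2 (code c) two-children) ⟩
    3                                                                     ∎
    where
    open ≤-Reasoning
    one-parent : ∀ y y′ → parent-edge a (node y) ≡ true → parent-edge a (node y′) ≡ true → y ≡ y′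
    one-parent y y′ e e′ = node-injective (trans (sym (proj₂ (parent-edge⇒ e))) (proj₂ (parent-edge⇒ e′)))
    two-children : ∀ y y′ → parent-edge (node y) a ≡ true → parent-edge (node y′) a ≡ true →
                   y ≢ code c → y′ ≢ code c → y ≡ y′
    two-children y y′ e e′ y≢c y′≢c = node-injective (children≤2 _ _ (parent-edge⇒ e) (parent-edge⇒ e′)
      (λ eq → y≢c (trans (sym (code-node y)) (cong code eq)))
      (λ eq → y′≢c (trans (sym (code-node y′)) (cong code eq))))

  degree≡1 : ∀ a c → Adjacent a c → (∀ b → Adjacent a b → b ≡ c) → degree tree (code a) ≡ 1
  degree≡1 a c ac only-c = trans (count≡cnt (adj tree (code a))) (cnt≡1 (code c) ac only-code-c)
    where
    only-code-c : ∀ y → adj tree (code a) y ≡ true → y ≡ code c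
    only-code-c y ay =
      trans (sym (code-node y)) (cong code (only-c (node y) (subst (λ x → adj tree (code a) x ≡ true) (sym (code-node y)) ay)))

  no-child⇒degree≡1 : ∀ a → a ≢ root → (∀ c → ¬ Child c a) → degree tree (code a) ≡ 1
  no-child⇒degree≡1 a a≢root no-child = degree≡1 a (parent a) (adjacent-parent a≢root) only-parent
    where
    only-parent : ∀ b → Adjacent a b → b ≡ parent a
    only-parent b ab with Adjacent⇒ ab
    ... | inj₁ (_ , pa≡b) = sym pa≡b
    ... | inj₂ b-child    = ⊥-elim (no-child b b-child)

  2≤degreeIn : (S : A → Bool) {a c : A} → a ≢ root → c ≢ root → parent c ≡ a → S (parent a) ≡ true → S c ≡ true →
               2 ≤ degreeIn tree (S ∘ node) (code a)
  2≤degreeIn S {a} {c} a≢root c≢root pc≡a spa sc = subst (2 ≤_) (sym (count≡cnt in-S-adjacent))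
    (2≤cnt {p = in-S-adjacent} (code (parent a)) (code c) (parent≢child a≢root c≢root pc≡a ∘ code-injective)
       (∧-intro (member-code S spa) (adjacent-parent a≢root))
       (∧-intro (member-code S sc) (subst (λ x → Adjacent x c) pc≡a (adjacent-child c≢root))))
    where
    in-S-adjacent : Fin N → Bool
    in-S-adjacent y = S (node y) ∧ adj tree (code a) y

  numLeaves≡cnt : (leaf : A → Bool) → (∀ a → leaf a ≡ true → degree tree (code a) ≡ 1) →
                  (∀ a → leaf a ≡ false → 2 ≤ degree tree (code a)) → numLeaves tree ≡ cnt (leaf ∘ node)
  numLeaves≡cnt leaf leaf⇒1 inner⇒2 = trans (count≡cnt (λ y → degree tree y ≡ᵇ 1)) (cnt-cong by-code)
    where
    by-kind : ∀ a → (degree tree (code a) ≡ᵇ 1) ≡ leaf a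
    by-kind a with leaf a in e
    ... | true  rewrite leaf⇒1 a e = refl
    ... | false with degree tree (code a) | inner⇒2 a e
    ...   | suc (suc _) | _ = refl
    ...   | suc zero    | s≤s ()
    by-code : ∀ y → (degree tree y ≡ᵇ 1) ≡ leaf (node y)
    by-code y = subst (λ x → (degree tree x ≡ᵇ 1) ≡ leaf (node y)) (code-node y) (by-kind (node y))

module Rooted {m : ℕ} (T : Graph m) (T-tree : IsTree T) (r : Fin m) where

  data Reaches : ℕ → Fin m → Set where
    root-reached : ∀ {t} → Reaches t r
    via          : ∀ {t x} y → adj T x y ≡ true → Reaches t y → Reaches (suc t) x

  reaches? : ∀ t x → Dec (Reaches t x)
  reaches? t x with x Fin.≟ r
  reaches? t       x | yes refl = yes root-reached
  reaches? zero    x | no x≢r   = no λ { root-reached → x≢r refl }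
  reaches? (suc t) x | no x≢r   =
    map′ (λ (y , xy , ry) → via y xy ry) first-step (Finₚ.any? (λ y → (adj T x y Boolₚ.≟ true) ×-dec reaches? t y))
    where
    first-step : Reaches (suc t) x → ∃ λ y → adj T x y ≡ true × Reaches t y
    first-step root-reached   = ⊥-elim (x≢r refl)
    first-step (via y xy ry) = y , xy , ry

  walk⇒reaches : ∀ {x} → ReachIn T (λ _ → true) x r → ∃ λ t → Reaches t x
  walk⇒reaches (here _)          = 0 , root-reached
  walk⇒reaches (step _ xy rest) = suc (proj₁ (walk⇒reaches rest)) , via _ xy (proj₂ (walk⇒reaches rest))

  opaque
    shortest : ∀ x → Σ ℕ λ t → does (reaches? t x) ≡ true × (∀ s → does (reaches? s x) ≡ true → t ≤ s)
    shortest x = least-ℕ (λ t → does (reaches? t x))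
                         (dec-true (reaches? _ x) (proj₂ (walk⇒reaches (proj₁ (proj₂ T-tree) x r))))

    depth : Fin m → ℕ
    depth x = proj₁ (shortest x)

    reaches-depth : ∀ x → Reaches (depth x) x
    reaches-depth x = does-true {a? = reaches? (depth x) x} (proj₁ (proj₂ (shortest x)))

    depth-minimal : ∀ {s x} → Reaches s x → depth x ≤ s
    depth-minimal {s} {x} rx = proj₂ (proj₂ (shortest x)) s (dec-true (reaches? s x) rx)

  depth-root : depth r ≡ 0
  depth-root = n≤0⇒n≡0 (depth-minimal {0} root-reached)

  depth≡0⇒root : ∀ {x} → depth x ≡ 0 → x ≡ r
  depth≡0⇒root {x} d≡0 = reaches-nothing (subst (λ t → Reaches t x) d≡0 (reaches-depth x))
    where
    reaches-nothing : Reaches 0 x → x ≡ r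
    reaches-nothing root-reached = refl

  0<depth⇒≢root : ∀ {x} → 0 < depth x → x ≢ r
  0<depth⇒≢root 0<d refl = <-irrefl (sym depth-root) 0<d

  next-vertex : ∀ {t x} → Reaches t x → Fin m
  next-vertex root-reached = r
  next-vertex (via y _ _) = y

  parent : Fin m → Fin m
  parent x = next-vertex (reaches-depth x)

  climb-step : ∀ {t x} (rx : Reaches t x) → x ≢ r →
               ∃ λ t′ → t ≡ suc t′ × adj T x (next-vertex rx) ≡ true × Reaches t′ (next-vertex rx)
  climb-step root-reached   x≢r = ⊥-elim (x≢r refl)
  climb-step (via y xy ry) _   = _ , refl , xy , ry

  parent-adj : ∀ {x} → x ≢ r → adj T x (parent x) ≡ true
  parent-adj {x} x≢r = proj₁ (proj₂ (proj₂ (climb-step (reaches-depth x) x≢r)))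

  depth-parent : ∀ {x} → x ≢ r → suc (depth (parent x)) ≡ depth x
  depth-parent {x} x≢r with climb-step (reaches-depth x) x≢r
  ... | t′ , d≡ , _ , r-parent =
    ≤-antisym (subst (suc (depth (parent x)) ≤_) (sym d≡) (s≤s (depth-minimal r-parent)))
              (depth-minimal (via (parent x) (parent-adj x≢r) (reaches-depth (parent x))))

  ancestor : ℕ → Fin m → Fin m
  ancestor zero    x = x
  ancestor (suc k) x = parent (ancestor k x)

  depth-ancestor : ∀ k x → k ≤ depth x → depth (ancestor k x) ≡ depth x ∸ k
  depth-ancestor zero    x _   = refl
  depth-ancestor (suc k) x k<d = begin
    depth (parent (ancestor k x))      ≡⟨ cong ℕ.pred (depth-parent anc≢r) ⟩
    ℕ.pred (depth (ancestor k x))      ≡⟨ cong ℕ.pred d-anc ⟩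
    ℕ.pred (depth x ∸ k)               ≡⟨ pred[m∸n]≡m∸[1+n] (depth x) k ⟩
    depth x ∸ suc k                    ∎
    where
    open ≡-Reasoning
    d-anc : depth (ancestor k x) ≡ depth x ∸ k
    d-anc = depth-ancestor k x (<⇒≤ k<d)
    anc≢r : ancestor k x ≢ r
    anc≢r = 0<depth⇒≢root (subst (0 <_) (sym d-anc) (m<n⇒0<n∸m k<d))

  ancestor-depth : ∀ x → ancestor (depth x) x ≡ r
  ancestor-depth x = depth≡0⇒root (trans (depth-ancestor (depth x) x ≤-refl) (n∸n≡0 (depth x)))

  IsParent : Fin m → Fin m → Set
  IsParent y x = x ≢ r × parent x ≡ y

  is-parent? : ∀ y x → Dec (IsParent y x)
  is-parent? y x = ¬? (x Fin.≟ r) ×-dec (parent x Fin.≟ y)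

  -- If neither end of the edge u v is the parent of the other, climbing from u to the
  -- root, descending to v and stepping back to u is a closed walk without backtracking.
  module NonParentEdge {u v} (uv : adj T u v ≡ true) (¬v↑u : ¬ IsParent v u) (¬u↑v : ¬ IsParent u v) where
    A B : ℕ
    A = depth u
    B = depth v

    w : ℕ → Fin m
    w t with t ≤? A
    ... | yes _ = ancestor (A ∸ t) u
    ... | no  _ = ancestor (t ∸ suc A) v

    w-left : ∀ {t} → t ≤ A → w t ≡ ancestor (A ∸ t) u
    w-left {t} t≤A with t ≤? A
    ... | yes _   = refl
    ... | no  t≰A = ⊥-elim (t≰A t≤A)

    w-right : ∀ j → w (suc A + j) ≡ ancestor j v
    w-right j with suc A + j ≤? A
    ... | yes A<A = ⊥-elim (<-irrefl refl (≤-trans (s≤s (m≤m+n A j)) A<A))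
    ... | no  _   = cong (λ k → ancestor k v) (m+n∸m≡n (suc A) j)

    depth-left : ∀ {t} → t ≤ A → depth (w t) ≡ t
    depth-left {t} t≤A = trans (cong depth (w-left t≤A))
                               (trans (depth-ancestor (A ∸ t) u (m∸n≤m A t)) (m∸[m∸n]≡n t≤A))

    depth-right : ∀ {j} → j ≤ B → depth (w (suc A + j)) ≡ B ∸ j
    depth-right {j} j≤B = trans (cong depth (w-right j)) (depth-ancestor j v j≤B)

    L : ℕ
    L = suc (A + B)

    w-u : w A ≡ u
    w-u = trans (w-left ≤-refl) (cong (λ k → ancestor k u) (n∸n≡0 A))

    w-v : w (suc A) ≡ v
    w-v = trans (cong (λ t → w (suc t)) (sym (+-identityʳ A))) (w-right 0)

    w-up : ∀ j → w (suc (suc A + j)) ≡ parent (ancestor j v)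
    w-up j = trans (cong w (sym (+-suc (suc A) j))) (w-right (suc j))

    w-from-right : ∀ {t} → A < t → ∃ λ j → t ≡ suc A + j
    w-from-right {t} A<t = t ∸ suc A , sym (m+[n∸m]≡n A<t)

    down-edge : ∀ {t} → t < A → adj T (w t) (w (suc t)) ≡ true
    down-edge {t} t<A = subst₂ (λ x y → adj T x y ≡ true) (sym w-t) (sym (w-left t<A))
                               (adj-sym {G = T} (parent-adj (0<depth⇒≢root 0<d)))
      where
      w-t : w t ≡ parent (ancestor (A ∸ suc t) u)
      w-t = trans (w-left (<⇒≤ t<A)) (cong (λ k → ancestor k u) (+-∸-assoc 1 t<A))
      0<d : 0 < depth (ancestor (A ∸ suc t) u)
      0<d = subst (0 <_) (sym (trans (cong depth (sym (w-left t<A))) (depth-left t<A))) (s≤s z≤n)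

    up-edge : ∀ {j} → j < B → adj T (w (suc A + j)) (w (suc (suc A + j))) ≡ true
    up-edge {j} j<B = subst₂ (λ x y → adj T x y ≡ true) (sym (w-right j)) (sym (w-up j)) (parent-adj anc≢r)
      where
      anc≢r : ancestor j v ≢ r
      anc≢r = 0<depth⇒≢root (subst (0 <_) (sym (depth-ancestor j v (<⇒≤ j<B))) (m<n⇒0<n∸m j<B))

    along-edges : ∀ t → t < L → adj T (w t) (w (suc t)) ≡ true
    along-edges t t<L with <-cmp t A
    ... | tri< t<A _ _ = down-edge t<A
    ... | tri≈ _ refl _ = subst₂ (λ x y → adj T x y ≡ true) (sym w-u) (sym w-v) uv
    ... | tri> _ _ A<t with w-from-right A<t
    ...   | j , refl = up-edge (+-cancelˡ-< A j B (≤-pred t<L))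

    no-backtrack : ∀ t → suc (suc t) ≤ L → w (suc (suc t)) ≢ w t
    no-backtrack t t+2≤L eq with <-cmp (suc t) A
    ... | tri< t+2≤A _ _ =
      <-irrefl (trans (sym (depth-left t≤A)) (trans (cong depth (sym eq)) (depth-left t+2≤A))) (m≤n⇒m≤1+n (n<1+n t))
      where
      t≤A : t ≤ A
      t≤A = ≤-trans (n≤1+n t) (≤-trans (n≤1+n (suc t)) t+2≤A)
    ... | tri≈ _ t+1≡A _ = ¬v↑u (u≢r , sym (trans (sym w-v′) (trans eq w-pu)))
      where
      u≢r : u ≢ r
      u≢r = 0<depth⇒≢root (subst (0 <_) t+1≡A (s≤s z≤n))
      w-v′ : w (suc (suc t)) ≡ v
      w-v′ = trans (cong (λ t → w (suc t)) t+1≡A) w-v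
      w-pu : w t ≡ parent u
      w-pu = trans (w-left (≤-trans (n≤1+n t) (≤-reflexive t+1≡A)))
                   (cong (λ k → ancestor k u) (trans (cong (_∸ t) (sym t+1≡A)) (m+n∸n≡m 1 t)))
    ... | tri> _ _ A<t+1 with m≤n⇒m<n∨m≡n (≤-pred A<t+1)
    ...   | inj₂ refl = ¬u↑v (v≢r , trans (sym (w-up 0)) (trans (cong (λ t → w (suc (suc t))) (+-identityʳ A))
                                                                (trans eq w-u)))
      where
      v≢r : v ≢ r
      v≢r = 0<depth⇒≢root (+-cancelˡ-≤ (suc A) 1 B (subst (_≤ suc A + B) (cong suc (+-comm 1 A)) t+2≤L))
    ...   | inj₁ A<t with w-from-right A<t
    ...     | j , refl = <-irrefl (sym depths) (∸-monoʳ-< (m≤n⇒m≤1+n (n<1+n j)) j+2≤B)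
      where
      shift : suc (suc (suc A + j)) ≡ suc A + suc (suc j)
      shift = sym (trans (+-suc (suc A) (suc j)) (cong suc (+-suc (suc A) j)))
      j+2≤B : suc (suc j) ≤ B
      j+2≤B = +-cancelˡ-≤ (suc A) (suc (suc j)) B (subst (_≤ suc A + B) shift t+2≤L)
      j≤B : j ≤ B
      j≤B = ≤-trans (n≤1+n j) (≤-trans (n≤1+n (suc j)) j+2≤B)
      depths : B ∸ j ≡ B ∸ suc (suc j)
      depths = trans (sym (depth-right j≤B))
                     (trans (cong depth (sym eq)) (trans (cong (depth ∘ w) shift) (depth-right j+2≤B)))

    closed-walk : NonBacktrackingWalk T L
    closed-walk = record { vertex = w ; along-edges = along-edges ; no-backtrack = no-backtrack }

    cycle : HasCycle T
    cycle = closed⇒cycle closed-walk (s≤s z≤n)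
      (trans (w-left z≤n) (trans (ancestor-depth u) (sym (trans (w-right B) (ancestor-depth v)))))

  adj⇒parent : ∀ {u v} → adj T u v ≡ true → IsParent v u ⊎ IsParent u v
  adj⇒parent {u} {v} uv with is-parent? v u | is-parent? u v
  ... | yes v↑u | _       = inj₁ v↑u
  ... | no _    | yes u↑v = inj₂ u↑v
  ... | no ¬v↑u | no ¬u↑v = ⊥-elim (proj₂ (proj₂ T-tree) (NonParentEdge.cycle uv ¬v↑u ¬u↑v))

  -- The climbing steps avoid the root, whose parent is meaningless.
  data Descendant (x : Fin m) : Fin m → Set where
    itself : Descendant x x
    under  : ∀ {a} → a ≢ r → Descendant x (parent a) → Descendant x a

  depth-parent< : ∀ {a} → a ≢ r → depth (parent a) < depth a
  depth-parent< a≢r = ≤-reflexive (depth-parent a≢r)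

  descendant-deeper : ∀ {x a} → Descendant x a → a ≡ x ⊎ depth x < depth a
  descendant-deeper itself = inj₁ refl
  descendant-deeper (under a≢r d) with descendant-deeper d
  ... | inj₁ refl = inj₂ (depth-parent< a≢r)
  ... | inj₂ x<pa = inj₂ (<-trans x<pa (depth-parent< a≢r))

  leave-descendants : ∀ {S x a b} → ReachIn T S a b → Descendant x a → ¬ Descendant x b → x ≢ r × S (parent x) ≡ true
  leave-descendants (here _) da ¬db = ⊥-elim (¬db da)
  leave-descendants {S} (step _ ab rest) da ¬db with adj⇒parent ab | da
  ... | inj₂ (b≢r , pb≡a) | _ = leave-descendants rest (under b≢r (subst (Descendant _) (sym pb≡a) da)) ¬db
  ... | inj₁ (a≢r , pa≡b) | itself = a≢r , subst (λ y → S y ≡ true) (sym pa≡b) (reach-start rest)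
  ... | inj₁ (a≢r , pa≡b) | under _ d-pa = leave-descendants rest (subst (Descendant _) pa≡b d-pa) ¬db

  top : (S : VSet m) → IsSubtree T S →
        Σ (Fin m) λ t → S t ≡ true × (∀ x → S x ≡ true → x ≢ t → x ≢ r × S (parent x) ≡ true)
  top S ((s , ss) , connected) with minimiser depth S ss
  ... | t , st , highest = t , st , closed
    where
    closed : ∀ x → S x ≡ true → x ≢ t → x ≢ r × S (parent x) ≡ true
    closed x sx x≢t = leave-descendants (connected x t sx st) itself t-outside
      where
      t-outside : ¬ Descendant x t
      t-outside d with descendant-deeper d
      ... | inj₁ t≡x = x≢t (sym t≡x)
      ... | inj₂ x<t = <⇒≱ x<t (highest x sx)

  childᵇ : Fin m → Fin m → Bool
  childᵇ y x = does (is-parent? x y)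

  childless : Fin m → Bool
  childless x = not (anyᵇ (λ y → childᵇ y x))

  childless⇒no-child : ∀ {x y} → childless x ≡ true → ¬ IsParent x y
  childless⇒no-child {x} {y} no-child y↑x
    with () ← trans (sym no-child) (cong not (anyᵇ-intro (λ z → childᵇ z x) y (dec-true (is-parent? x y) y↑x)))

  has-child : ∀ {x} → childless x ≡ false → ∃ λ y → IsParent x y
  has-child {x} has with anyᵇ-witness (λ y → childᵇ y x) (trans (sym (Boolₚ.not-involutive _)) (cong not has))
  ... | y , y↑x = y , does-true {a? = is-parent? x y} y↑x

  childless⇒degree≡1 : ∀ {x} → x ≢ r → childless x ≡ true → degree T x ≡ 1
  childless⇒degree≡1 {x} x≢r no-child = trans (count≡cnt (adj T x)) (cnt≡1 (parent x) (parent-adj x≢r) only-parent)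
    where
    only-parent : ∀ y → adj T x y ≡ true → y ≡ parent x
    only-parent y xy with adj⇒parent xy
    ... | inj₁ (_ , px≡y) = sym px≡y
    ... | inj₂ y↑x = ⊥-elim (childless⇒no-child no-child y↑x)

  deepest⇒childless : ∀ {x} → (∀ z → depth z ≤ depth x) → childless x ≡ true
  deepest⇒childless {x} deepest with childless x in e
  ... | true  = refl
  ... | false with has-child e
  ...   | y , y≢r , py≡x = ⊥-elim (<⇒≱ (subst (λ z → depth z < depth y) py≡x (depth-parent< y≢r)) (deepest y))

  -- When the root is a leaf it has a child, so the childless vertices and the root are
  -- distinct leaves.
  childless+root≤leaves : degree T r ≡ 1 → suc (cnt childless) ≤ numLeaves T
  childless+root≤leaves root-leaf = begin
    suc (cnt childless)                   ≡⟨ +-comm 1 (cnt childless) ⟩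
    cnt childless + 1                     ≡⟨ cong (cnt childless +_) (sym root-once) ⟩
    cnt childless + cnt is-root           ≡⟨ sym (cnt-∨-disjoint childless is-root disjoint) ⟩
    cnt (λ x → childless x ∨ is-root x)   ≤⟨ cnt-mono leaf ⟩
    cnt (λ x → degree T x ≡ᵇ 1)           ≡⟨ sym (count≡cnt (λ x → degree T x ≡ᵇ 1)) ⟩
    numLeaves T                           ∎
    where
    open ≤-Reasoning
    is-root : Fin m → Bool
    is-root x = does (x Fin.≟ r)
    root-once : cnt is-root ≡ 1
    root-once = cnt≡1 r (dec-true (r Fin.≟ r) refl) (λ x e → does-true {a? = x Fin.≟ r} e)
    root-has-child : childless r ≡ false
    root-has-child with childless r in cl | cnt-witness (adj T r) (≤-reflexive (sym (trans (sym (count≡cnt (adj T r))) root-leaf)))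
    ... | false | _ = refl
    ... | true  | y , ry with adj⇒parent ry
    ...   | inj₁ (r≢r , _) = ⊥-elim (r≢r refl)
    ...   | inj₂ y↑r = ⊥-elim (childless⇒no-child cl y↑r)
    disjoint : ∀ x → childless x ≡ true → is-root x ≡ false
    disjoint x cl = dec-false (x Fin.≟ r) λ { refl → Boolₚ.not-¬ cl root-has-child }
    leaf : ∀ x → (childless x ∨ is-root x) ≡ true → (degree T x ≡ᵇ 1) ≡ true
    leaf x e with childless x in cl
    ... | true  rewrite childless⇒degree≡1 (λ { refl → Boolₚ.not-¬ cl root-has-child }) cl = refl
    ... | false with refl ← does-true {a? = x Fin.≟ r} e rewrite root-leaf = refl

module Construction {m : ℕ} (T : Graph m) (T-tree : IsTree T) (r : Fin m) (q n : ℕ)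
                    (S : Fin n → VSet m) (S-subtree : ∀ i → IsSubtree T (S i)) where

  open Rooted T T-tree r

  -- Its children c₁ < ⋯ < cₖ hang off the chain V x – Z x – H c₁ – ⋯ – H cₖ
  -- through V cᵢ – H cᵢ.  The extra leaves D j hang off the spine V r – C 0 – ⋯ – C (q - 1),
  -- and the new root apex is a leaf above H r.
  Base : Set
  Base = Fin m ⊎ Fin m ⊎ Fin m ⊎ Fin q ⊎ Fin q

  pattern V x = inj₁ x
  pattern Z x = inj₂ (inj₁ x)
  pattern H x = inj₂ (inj₂ (inj₁ x))
  pattern C j = inj₂ (inj₂ (inj₂ (inj₁ j)))
  pattern D j = inj₂ (inj₂ (inj₂ (inj₂ j)))

  -- The edge from a base node b up to its parent is subdivided by sub b 0, …, sub b (n + n),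
  -- counted downwards from the parent.
  M : ℕ
  M = suc (n + n)

  Node : Set
  Node = ⊤ ⊎ Base ⊎ (Base × Fin M)

  pattern apex    = inj₁ tt
  pattern base b  = inj₂ (inj₁ b)
  pattern sub b j = inj₂ (inj₂ (b , j))

  base-count : ℕ
  base-count = m + (m + (m + (q + q)))

  bases : Fin base-count ↔ Base
  bases = ↔-trans +↔⊎ (↔-refl ⊎-cong ↔-trans +↔⊎ (↔-refl ⊎-cong ↔-trans +↔⊎
            (↔-refl ⊎-cong ↔-trans +↔⊎ (↔-refl ⊎-cong ↔-refl))))

  non-apex : Fin (base-count + base-count * M) ↔ (Base ⊎ Base × Fin M)
  non-apex = ↔-trans +↔⊎ (bases ⊎-cong ↔-trans *↔× (bases ×-cong ↔-refl))

  N : ℕ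
  N = 1 + (base-count + base-count * M)

  nodes : Fin N ↔ Node
  nodes = ↔-trans +↔⊎ (1↔⊤ ⊎-cong non-apex)

  earlier-sibling : Fin m → Fin m → Bool
  earlier-sibling x y = childᵇ y (parent x) ∧ does (y Fin.<? x)

  earlier-sibling⇒ : ∀ {x y} → earlier-sibling x y ≡ true → IsParent (parent x) y × y Fin.< x
  earlier-sibling⇒ {x} {y} e with ∧-elim (childᵇ y (parent x)) e
  ... | y↑ , y<x = does-true {a? = is-parent? (parent x) y} y↑ , does-true {a? = y Fin.<? x} y<x

  earlier-sibling-intro : ∀ {x y} → IsParent (parent x) y → y Fin.< x → earlier-sibling x y ≡ true
  earlier-sibling-intro {x} {y} y↑ y<x = ∧-intro (dec-true (is-parent? (parent x) y) y↑) (dec-true (y Fin.<? x) y<x)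

  previous-sibling : Fin m → Maybe (Fin m)
  previous-sibling x = last (earlier-sibling x)

  hub-above : (x : Fin m) → Dec (x ≡ r) → Maybe (Fin m) → Maybe Base
  hub-above x (yes _) _        = nothing
  hub-above x (no _)  (just y) = just (H y)
  hub-above x (no _)  nothing  = just (Z (parent x))

  -- the base node at the upper end of the edge above b; nothing stands for the apex
  above : Base → Maybe Base
  above (V x)       = just (H x)
  above (Z x)       = just (V x)
  above (H x)       = hub-above x (x Fin.≟ r) (previous-sibling x)
  above (C zero)    = just (V r)
  above (C (suc j)) = just (C (inject₁ j))
  above (D j)       = just (C j)

  data HubAbove (x : Fin m) : Maybe Base → Set where
    at-root     : x ≡ r → HubAbove x nothing
    after       : ∀ {y} → x ≢ r → IsLast (earlier-sibling x) (just y) → HubAbove x (just (H y))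
    eldest      : x ≢ r → IsLast (earlier-sibling x) nothing → HubAbove x (just (Z (parent x)))

  hub-above-view : ∀ x → HubAbove x (above (H x))
  hub-above-view x with x Fin.≟ r | previous-sibling x | last-correct (earlier-sibling x)
  ... | yes x≡r | _       | _    = at-root x≡r
  ... | no  x≢r | just y  | spec = after x≢r spec
  ... | no  x≢r | nothing | spec = eldest x≢r spec

  depth-sibling : ∀ {x y} → IsParent (parent x) y → x ≢ r → depth y ≡ depth x
  depth-sibling {x} (y≢r , py≡px) x≢r =
    trans (sym (depth-parent y≢r)) (trans (cong (suc ∘ depth) py≡px) (depth-parent x≢r))

  eldest-child : ∀ {z y} → IsParent z y → ∃ λ f → IsParent z f × IsLast (earlier-sibling f) nothing
  eldest-child {z} {y} y↑z = descend (suc (toℕ y)) y (n<1+n _) y↑z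
    where
    descend : ∀ k y → toℕ y < k → IsParent z y → ∃ λ f → IsParent z f × IsLast (earlier-sibling f) nothing
    descend (suc k) y y<k y↑z@(y≢r , py≡z) with previous-sibling y | last-correct (earlier-sibling y)
    ... | nothing | none = y , y↑z , none
    ... | just w  | ew , _ with earlier-sibling⇒ ew
    ...   | (w≢r , pw≡py) , w<y = descend k w (≤-trans w<y (≤-pred y<k)) (w≢r , trans pw≡py py≡z)

  eldest-unique : ∀ {f f′} → IsParent (parent f) f′ → f ≢ r →
                  IsLast (earlier-sibling f) nothing → IsLast (earlier-sibling f′) nothing → f ≡ f′
  eldest-unique {f} {f′} (f′≢r , pf′≡pf) f≢r none none′ with <-cmp (toℕ f) (toℕ f′)
  ... | tri< f<f′ _ _ with () ← trans (sym (none′ f)) (earlier-sibling-intro (f≢r , sym pf′≡pf) f<f′)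
  ... | tri≈ _ f≡f′ _ = toℕ-injective f≡f′
  ... | tri> _ _ f′<f with () ← trans (sym (none f′)) (earlier-sibling-intro (f′≢r , pf′≡pf) f′<f)

  next-sibling-unique : ∀ {x w w′} → w ≢ r → w′ ≢ r →
                        IsLast (earlier-sibling w) (just x) → IsLast (earlier-sibling w′) (just x) → w ≡ w′
  next-sibling-unique {x} {w} {w′} w≢r w′≢r (ex , after-x) (ex′ , after-x′)
    with earlier-sibling⇒ ex | earlier-sibling⇒ ex′
  ... | (_ , px≡pw) , x<w | (_ , px≡pw′) , x<w′ with <-cmp (toℕ w) (toℕ w′)
  ...   | tri< w<w′ _ _
    with () ← trans (sym (after-x′ w x<w)) (earlier-sibling-intro (w≢r , trans (sym px≡pw) px≡pw′) w<w′)
  ...   | tri≈ _ w≡w′ _ = toℕ-injective w≡w′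
  ...   | tri> _ _ w′<w
    with () ← trans (sym (after-x w′ x<w′)) (earlier-sibling-intro (w′≢r , trans (sym px≡pw′) px≡pw) w′<w)

  K : ℕ
  K = suc (suc m)

  -- Ranks decrease towards the apex: the hub of a vertex of depth d + 1 lies below everything
  -- built for a vertex of depth d.
  rank : Base → ℕ
  rank (V x) = suc (depth x * K + m)
  rank (Z x) = suc (depth x * K + suc m)
  rank (H x) = suc (depth x * K + toℕ x)
  rank (C j) = suc (suc (m + toℕ j))
  rank (D j) = suc (suc (suc (m + toℕ j)))

  rank↑ : Maybe Base → ℕ
  rank↑ nothing  = 0
  rank↑ (just b) = rank b

  rank-above : ∀ b → rank↑ (above b) < rank b
  rank-above (V x) = s≤s (+-monoʳ-< (depth x * K) (toℕ<n x))
  rank-above (Z x) = s≤s (+-monoʳ-< (depth x * K) (n<1+n m))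
  rank-above (H x) with above (H x) | hub-above-view x
  ... | _ | at-root _ = s≤s z≤n
  ... | _ | after x≢r (ey , _) with earlier-sibling⇒ ey
  ...   | y↑ , y<x = s≤s (subst (λ d → d * K + toℕ _ < depth x * K + toℕ x) (sym (depth-sibling y↑ x≢r))
                              (+-monoʳ-< (depth x * K) y<x))
  rank-above (H x) | _ | eldest x≢r _ = s≤s (begin-strict
    depth (parent x) * K + suc m       <⟨ +-monoʳ-< (depth (parent x) * K) (n<1+n (suc m)) ⟩
    depth (parent x) * K + K           ≡⟨ +-comm (depth (parent x) * K) K ⟩
    suc (depth (parent x)) * K         ≡⟨ cong (_* K) (depth-parent x≢r) ⟩
    depth x * K                        ≤⟨ m≤m+n (depth x * K) (toℕ x) ⟩
    depth x * K + toℕ x                ∎)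
    where open ≤-Reasoning
  rank-above (C zero) rewrite depth-root | +-identityʳ m = ≤-refl
  rank-above (C (suc j)) = s≤s (s≤s (+-monoʳ-< m (subst (_< suc (toℕ j)) (sym (toℕ-inject₁ j)) (n<1+n (toℕ j)))))
  rank-above (D j) = n<1+n _

  upper : Base → Node
  upper b = maybe base apex (above b)

  last-position : Fin M
  last-position = fromℕ (n + n)

  up : Node → Node
  up apex             = apex
  up (base b)         = sub b last-position
  up (sub b zero)     = upper b
  up (sub b (suc j))  = sub b (inject₁ j)

  height : Node → ℕ
  height apex      = 0
  height (base b)  = rank b * suc M
  height (sub b j) = rank↑ (above b) * suc M + suc (toℕ j)

  height-upper : ∀ b → height (upper b) ≡ rank↑ (above b) * suc M
  height-upper b with above b
  ... | nothing = refl
  ... | just _  = refl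

  height-up : ∀ a → a ≢ apex → height (up a) < height a
  height-up apex a≢apex = ⊥-elim (a≢apex refl)
  height-up (base b) _ = begin-strict
    rank↑ (above b) * suc M + suc (toℕ last-position)
      ≡⟨ cong (λ k → rank↑ (above b) * suc M + suc k) (toℕ-fromℕ (n + n)) ⟩
    rank↑ (above b) * suc M + M                       <⟨ +-monoʳ-< (rank↑ (above b) * suc M) (n<1+n M) ⟩
    rank↑ (above b) * suc M + suc M                   ≡⟨ +-comm (rank↑ (above b) * suc M) (suc M) ⟩
    suc (rank↑ (above b)) * suc M                     ≤⟨ *-monoˡ-≤ (suc M) (rank-above b) ⟩
    rank b * suc M                                    ∎
    where open ≤-Reasoning
  height-up (sub b zero) _ = subst (_< rank↑ (above b) * suc M + 1) (sym (height-upper b)) (m<m+n _ (s≤s z≤n))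
  height-up (sub b (suc j)) _ = +-monoʳ-< (rank↑ (above b) * suc M) (s≤s (s≤s (≤-reflexive (toℕ-inject₁ j))))

  open ParentTree nodes up apex height height-up public

  data Beneath : Base → Base → Set where
    Z-V : ∀ {x} → Beneath (Z x) (V x)
    C-V : ∀ {j x} → x ≡ r → toℕ j ≡ 0 → Beneath (C j) (V x)
    H-Z : ∀ {f x} → IsParent x f → IsLast (earlier-sibling f) nothing → Beneath (H f) (Z x)
    V-H : ∀ {x} → Beneath (V x) (H x)
    H-H : ∀ {w x} → w ≢ r → IsLast (earlier-sibling w) (just x) → Beneath (H w) (H x)
    D-C : ∀ {j} → Beneath (D j) (C j)
    C-C : ∀ {j k} → toℕ j ≡ suc (toℕ k) → Beneath (C j) (C k)

  beneath : ∀ b′ {b} → above b′ ≡ just b → Beneath b′ b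
  beneath (V x) refl = V-H
  beneath (Z x) refl = Z-V
  beneath (H w) eq with above (H w) | hub-above-view w
  beneath (H w) refl | _ | after w≢r spec = H-H w≢r spec
  beneath (H w) refl | _ | eldest w≢r spec = H-Z (w≢r , refl) spec
  beneath (C zero) refl = C-V refl refl
  beneath (C (suc k)) refl = C-C (cong suc (sym (toℕ-inject₁ k)))
  beneath (D j) refl = D-C

  above≡nothing : ∀ {b} → above b ≡ nothing → b ≡ H r
  above≡nothing {H x} eq with above (H x) | hub-above-view x
  above≡nothing {H x} refl | _ | at-root x≡r = cong H x≡r
  above≡nothing {C zero}    ()
  above≡nothing {C (suc _)} ()
  above≡nothing {D _}       ()

  upper≡ : ∀ b′ {mb} → upper b′ ≡ maybe base apex mb → above b′ ≡ mb
  upper≡ b′ {mb} eq with above b′ | mb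
  ... | nothing | nothing = refl
  ... | just b  | just b₀ with refl ← eq = refl

  Child-of-upper : ∀ {c mb} → Child c (maybe base apex mb) → ∃ λ b′ → c ≡ sub b′ zero × above b′ ≡ mb
  Child-of-upper {apex} (c≢apex , _) = ⊥-elim (c≢apex refl)
  Child-of-upper {base b′} {nothing} (_ , ())
  Child-of-upper {base b′} {just b} (_ , ())
  Child-of-upper {sub b′ zero} (_ , eq) = b′ , refl , upper≡ b′ eq
  Child-of-upper {sub b′ (suc k)} {nothing} (_ , ())
  Child-of-upper {sub b′ (suc k)} {just b} (_ , ())

  below : Base → Fin M → Node
  below b j with n + n ℕ.≟ toℕ j
  ... | yes _     = base b
  ... | no  j≢end = sub b (suc (lower₁ j j≢end))

  below≢apex : ∀ b j → below b j ≢ apex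
  below≢apex b j with n + n ℕ.≟ toℕ j
  ... | yes _ = λ ()
  ... | no  _ = λ ()

  up-below : ∀ b j → up (below b j) ≡ sub b j
  up-below b j with n + n ℕ.≟ toℕ j
  ... | yes end   = cong (sub b) (toℕ-injective (trans (toℕ-fromℕ (n + n)) end))
  ... | no  j≢end = cong (sub b) (inject₁-lower₁ j j≢end)

  Child-of-sub : ∀ {c b j} → Child c (sub b j) → c ≡ below b j
  Child-of-sub {apex} (c≢apex , _) = ⊥-elim (c≢apex refl)
  Child-of-sub {base b} {j = j} (_ , refl) with n + n ℕ.≟ toℕ last-position
  ... | yes _     = refl
  ... | no  j≢end = ⊥-elim (j≢end (sym (toℕ-fromℕ (n + n))))
  Child-of-sub {sub b′ zero} (_ , eq) with above b′
  Child-of-sub {sub b′ zero} (_ , ()) | nothing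
  Child-of-sub {sub b′ zero} (_ , ()) | just _
  Child-of-sub {sub b (suc k)} (_ , refl) with n + n ℕ.≟ toℕ (inject₁ k)
  ... | yes end   = ⊥-elim (toℕ-inject₁-≢ k end)
  ... | no  j≢end = cong (λ k′ → sub b (suc k′)) (sym (lower₁-inject₁′ k j≢end))

  BaseChild : Base → Node → Set
  BaseChild b c = ∃ λ b′ → c ≡ sub b′ zero × Beneath b′ b

  base-child : ∀ {b c} → Child c (base b) → BaseChild b c
  base-child ch with Child-of-upper ch
  ... | b′ , c≡ , eq = b′ , c≡ , beneath b′ eq

  above-H-root : above (H r) ≡ nothing
  above-H-root with above (H r) | hub-above-view r
  ... | _ | at-root _        = refl
  ... | _ | after r≢r _      = ⊥-elim (r≢r refl)
  ... | _ | eldest r≢r _     = ⊥-elim (r≢r refl)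

  above-eldest : ∀ {x f} → IsParent x f → IsLast (earlier-sibling f) nothing → above (H f) ≡ just (Z x)
  above-eldest {x} {f} (f≢r , pf≡x) none with above (H f) | hub-above-view f
  ... | _ | at-root f≡r          = ⊥-elim (f≢r f≡r)
  ... | _ | after _ (ey , _)     with () ← trans (sym (none _)) ey
  ... | _ | eldest _ _           = cong (just ∘ Z) pf≡x

  other-children-unique : ∀ b → ∃ λ d → ∀ c c′ → Child c (base b) → Child c′ (base b) → c ≢ d → c′ ≢ d → c ≡ c′
  other-children-unique (V x) = sub (Z x) zero , λ c c′ ch ch′ → unique (base-child ch) (base-child ch′)
    where
    unique : ∀ {c c′} → BaseChild (V x) c → BaseChild (V x) c′ → c ≢ sub (Z x) zero → c′ ≢ sub (Z x) zero → c ≡ c′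
    unique (_ , refl , Z-V) _ c≢ _ = ⊥-elim (c≢ refl)
    unique _ (_ , refl , Z-V) _ c′≢ = ⊥-elim (c′≢ refl)
    unique (_ , refl , C-V _ j≡0) (_ , refl , C-V _ j′≡0) _ _ =
      cong (λ j → sub (C j) zero) (toℕ-injective (trans j≡0 (sym j′≡0)))
  other-children-unique (Z x) = apex , λ c c′ ch ch′ _ _ → unique (base-child ch) (base-child ch′)
    where
    unique : ∀ {c c′} → BaseChild (Z x) c → BaseChild (Z x) c′ → c ≡ c′
    unique (_ , refl , H-Z (f≢r , pf≡x) none) (_ , refl , H-Z (f′≢r , pf′≡x) none′) =
      cong (λ f → sub (H f) zero) (eldest-unique (f′≢r , trans pf′≡x (sym pf≡x)) f≢r none none′)
  other-children-unique (H x) = sub (V x) zero , λ c c′ ch ch′ → unique (base-child ch) (base-child ch′)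
    where
    unique : ∀ {c c′} → BaseChild (H x) c → BaseChild (H x) c′ → c ≢ sub (V x) zero → c′ ≢ sub (V x) zero → c ≡ c′
    unique (_ , refl , V-H) _ c≢ _ = ⊥-elim (c≢ refl)
    unique _ (_ , refl , V-H) _ c′≢ = ⊥-elim (c′≢ refl)
    unique (_ , refl , H-H w≢r spec) (_ , refl , H-H w′≢r spec′) _ _ =
      cong (λ w → sub (H w) zero) (next-sibling-unique w≢r w′≢r spec spec′)
  other-children-unique (C j) = sub (D j) zero , λ c c′ ch ch′ → unique (base-child ch) (base-child ch′)
    where
    unique : ∀ {c c′} → BaseChild (C j) c → BaseChild (C j) c′ → c ≢ sub (D j) zero → c′ ≢ sub (D j) zero → c ≡ c′
    unique (_ , refl , D-C) _ c≢ _ = ⊥-elim (c≢ refl)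
    unique _ (_ , refl , D-C) _ c′≢ = ⊥-elim (c′≢ refl)
    unique (_ , refl , C-C k≡) (_ , refl , C-C k′≡) _ _ =
      cong (λ k → sub (C k) zero) (toℕ-injective (trans k≡ (sym k′≡)))
  other-children-unique (D j) = apex , λ c c′ ch → ⊥-elim (no-child (base-child ch))
    where
    no-child : ∀ {c} → ¬ BaseChild (D j) c
    no-child (_ , _ , ())

  degree≤3-everywhere : ∀ y → degree tree y ≤ 3
  degree≤3-everywhere y = subst (λ x → degree tree x ≤ 3) (code-node y) (by-node (node y))
    where
    by-node : ∀ a → degree tree (code a) ≤ 3
    by-node apex = degree≤3 apex (sub (H r) zero) λ c c′ ch _ c≢ _ → ⊥-elim (c≢ (only-H-r ch))
      where
      only-H-r : ∀ {c} → Child c apex → c ≡ sub (H r) zero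
      only-H-r ch with Child-of-upper {mb = nothing} ch
      ... | b′ , refl , eq = cong (λ b → sub b zero) (above≡nothing eq)
    by-node (base b) = degree≤3 (base b) (proj₁ (other-children-unique b)) (proj₂ (other-children-unique b))
    by-node (sub b j) = degree≤3 (sub b j) (below b j) λ c c′ ch _ c≢ _ → ⊥-elim (c≢ (Child-of-sub ch))

  is-leaf : Node → Bool
  is-leaf apex         = true
  is-leaf (base (Z x)) = childless x
  is-leaf (base (D j)) = true
  is-leaf _            = false

  leaf⇒degree≡1 : ∀ a → is-leaf a ≡ true → degree tree (code a) ≡ 1
  leaf⇒degree≡1 apex _ = degree≡1 apex (sub (H r) zero) apex-H-r only-H-r
    where
    apex-H-r : Adjacent apex (sub (H r) zero)
    apex-H-r = subst (λ a → Adjacent a (sub (H r) zero)) (cong (maybe base apex) above-H-root)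
                     (adjacent-child {sub (H r) zero} (λ ()))
    only-H-r : ∀ c → Adjacent apex c → c ≡ sub (H r) zero
    only-H-r c ac with Adjacent⇒ {apex} {c} ac
    ... | inj₁ (apex≢apex , _) = ⊥-elim (apex≢apex refl)
    ... | inj₂ ch with Child-of-upper {mb = nothing} ch
    ...   | b′ , refl , eq = cong (λ b → sub b zero) (above≡nothing eq)
  leaf⇒degree≡1 (base (Z x)) no-child = no-child⇒degree≡1 (base (Z x)) (λ ()) λ c ch → childless-Z (base-child ch)
    where
    childless-Z : ∀ {c} → ¬ BaseChild (Z x) c
    childless-Z (_ , _ , H-Z f↑x _) = childless⇒no-child no-child f↑x
  leaf⇒degree≡1 (base (D j)) _ = no-child⇒degree≡1 (base (D j)) (λ ()) λ c ch → childless-D (base-child ch)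
    where
    childless-D : ∀ {c} → ¬ BaseChild (D j) c
    childless-D (_ , _ , ())

  inner⇒2≤degree : ∀ a → is-leaf a ≡ false → 2 ≤ degree tree (code a)
  inner⇒2≤degree (base (V x)) _ = 2≤degreeIn (λ _ → true) {c = sub (Z x) zero} (λ ()) (λ ()) refl refl refl
  inner⇒2≤degree (base (Z x)) has with eldest-child (proj₂ (has-child has))
  ... | f , f↑x , none =
    2≤degreeIn (λ _ → true) {c = sub (H f) zero} (λ ()) (λ ()) (cong (maybe base apex) (above-eldest f↑x none)) refl refl
  inner⇒2≤degree (base (H x)) _ = 2≤degreeIn (λ _ → true) {c = sub (V x) zero} (λ ()) (λ ()) refl refl refl
  inner⇒2≤degree (base (C j)) _ = 2≤degreeIn (λ _ → true) {c = sub (D j) zero} (λ ()) (λ ()) refl refl refl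
  inner⇒2≤degree (sub b j) _ = 2≤degreeIn (λ _ → true) {c = below b j} (λ ()) (below≢apex b j) (up-below b j) refl refl

  leaves-of-bases : cnt (is-leaf ∘ base ∘ Inverse.to bases) ≡ cnt childless + q
  leaves-of-bases =
    trans (cnt-⊎ ↔-refl Z-H-C-D (λ b → is-leaf (base b))) (cong₂ _+_ (cnt-const-false m)
    (trans (cnt-⊎ ↔-refl H-C-D (λ b → is-leaf (base (inj₂ b)))) (cong (cnt childless +_)
    (trans (cnt-⊎ ↔-refl C-D (λ b → is-leaf (base (inj₂ (inj₂ b))))) (cong₂ _+_ (cnt-const-false m)
    (trans (cnt-⊎ ↔-refl ↔-refl (λ b → is-leaf (base (inj₂ (inj₂ (inj₂ b))))))
           (cong₂ _+_ (cnt-const-false q) (cnt-const-true q))))))))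
    where
    C-D : Fin (q + q) ↔ (Fin q ⊎ Fin q)
    C-D = ↔-trans +↔⊎ (↔-refl ⊎-cong ↔-refl)
    H-C-D : Fin (m + (q + q)) ↔ (Fin m ⊎ Fin q ⊎ Fin q)
    H-C-D = ↔-trans +↔⊎ (↔-refl ⊎-cong C-D)
    Z-H-C-D : Fin (m + (m + (q + q))) ↔ (Fin m ⊎ Fin m ⊎ Fin q ⊎ Fin q)
    Z-H-C-D = ↔-trans +↔⊎ (↔-refl ⊎-cong H-C-D)

  leaf-count : numLeaves tree ≡ suc (cnt childless + q)
  leaf-count = begin
    numLeaves tree
      ≡⟨ numLeaves≡cnt is-leaf leaf⇒degree≡1 inner⇒2≤degree ⟩
    cnt (is-leaf ∘ node)
      ≡⟨ cnt-⊎ 1↔⊤ non-apex is-leaf ⟩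
    suc (cnt (is-leaf ∘ inj₂ ∘ Inverse.to non-apex))
      ≡⟨ cong suc (cnt-⊎ bases (↔-trans *↔× (bases ×-cong ↔-refl)) (is-leaf ∘ inj₂)) ⟩
    suc (cnt (is-leaf ∘ base ∘ Inverse.to bases) + cnt {base-count * M} (λ _ → false))
      ≡⟨ cong suc (cong₂ _+_ leaves-of-bases (cnt-const-false (base-count * M))) ⟩
    suc (cnt childless + q + 0)
      ≡⟨ cong suc (+-identityʳ _) ⟩
    suc (cnt childless + q)                                     ∎
    where open ≡-Reasoning

  member-child-from : Fin n → Fin m → ℕ → Bool
  member-child-from i z k = anyᵇ (λ y → childᵇ y z ∧ (does (k ≤? toℕ y) ∧ S i y))

  member-child-from⇒ : ∀ {i z k} → member-child-from i z k ≡ true → ∃ λ y → IsParent z y × k ≤ toℕ y × S i y ≡ true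
  member-child-from⇒ {i} {z} {k} e with anyᵇ-witness _ e
  ... | y , ey with ∧-elim (childᵇ y z) ey
  ...   | y↑z , rest with ∧-elim (does (k ≤? toℕ y)) rest
  ...     | k≤y , sy = y , does-true {a? = is-parent? z y} y↑z , does-true {a? = k ≤? toℕ y} k≤y , sy

  member-child-from-intro : ∀ {i z k y} → IsParent z y → k ≤ toℕ y → S i y ≡ true → member-child-from i z k ≡ true
  member-child-from-intro {i} {z} {k} {y} y↑z k≤y sy =
    anyᵇ-intro _ y (∧-intro (dec-true (is-parent? z y) y↑z) (∧-intro (dec-true (k ≤? toℕ y) k≤y) sy))

  -- The image of S i contains a hub on the chain below parent x exactly when S i continues
  -- beyond it, to a sibling of x not before x.
  memberᵇ : Fin n → Base → Bool
  memberᵇ i (V x) = S i x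
  memberᵇ i (Z x) = S i x ∧ member-child-from i x 0
  memberᵇ i (H x) = not (does (x Fin.≟ r)) ∧ (S i (parent x) ∧ member-child-from i (parent x) (toℕ x))
  memberᵇ i (C _) = false
  memberᵇ i (D _) = false

  member↑ : Fin n → Maybe Base → Bool
  member↑ i = maybe (memberᵇ i) false

  -- Which points p of a subdivided edge the image of S i contains, given whether it contains
  -- the upper and the lower end: a partial edge stops at p = i from above and at p = n + i
  -- from below, so that images of different sets never end at the same point.
  on-edge : Bool → Bool → ℕ → ℕ → Bool
  on-edge true  true  p k = true
  on-edge true  false p k = does (p ≤? k)
  on-edge false true  p k = does (n + k ≤? p)
  on-edge false false p k = false

  member : Fin n → Node → Bool
  member i apex      = false
  member i (base b)  = memberᵇ i b
  member i (sub b j) = on-edge (member↑ i (above b)) (memberᵇ i b) (toℕ j) (toℕ i)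

  member-upper : ∀ i b → member i (upper b) ≡ member↑ i (above b)
  member-upper i b with above b
  ... | nothing = refl
  ... | just _  = refl

  memberᵇ-H⇒ : ∀ {i x} → memberᵇ i (H x) ≡ true →
               x ≢ r × S i (parent x) ≡ true × ∃ λ w → IsParent (parent x) w × toℕ x ≤ toℕ w × S i w ≡ true
  memberᵇ-H⇒ {i} {x} e with ∧-elim (not (does (x Fin.≟ r))) e
  ... | x≢r , rest with ∧-elim (S i (parent x)) rest
  ...   | spx , siblings = not-does {a? = x Fin.≟ r} x≢r , spx , member-child-from⇒ siblings

  memberᵇ-H-intro : ∀ {i x w} → x ≢ r → S i (parent x) ≡ true → IsParent (parent x) w → toℕ x ≤ toℕ w → S i w ≡ true →
                    memberᵇ i (H x) ≡ true
  memberᵇ-H-intro {x = x} x≢r spx w↑ x≤w sw =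
    ∧-intro (cong not (dec-false (x Fin.≟ r) x≢r)) (∧-intro spx (member-child-from-intro w↑ x≤w sw))

  on-edge-bottom : ∀ {U B k} → k < n → B ≡ true → on-edge U B (n + n) k ≡ true
  on-edge-bottom {true}          _   refl = refl
  on-edge-bottom {false} {k = k} k<n refl = dec-true (n + k ≤? n + n) (+-monoʳ-≤ n (<⇒≤ k<n))

  on-edge-bottom⇒lower : ∀ {U B k} → k < n → on-edge U B (n + n) k ≡ true → B ≡ true
  on-edge-bottom⇒lower {_}    {true}          _   _ = refl
  on-edge-bottom⇒lower {true} {false} {k = k} k<n e =
    ⊥-elim (<⇒≱ (≤-trans k<n (m≤m+n n n)) (does-true {a? = n + n ≤? k} e))

  on-edge-top⇒upper : ∀ {U B k} → k < n → on-edge U B 0 k ≡ true → U ≡ true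
  on-edge-top⇒upper {true}                 _   _ = refl
  on-edge-top⇒upper {false} {true} {k = k} k<n e =
    ⊥-elim (n≮0 (≤-trans (≤-trans (s≤s z≤n) k<n) (≤-trans (m≤m+n n k) (does-true {a? = n + k ≤? 0} e))))

  on-edge-top : ∀ {U B k} → U ≡ true → on-edge U B 0 k ≡ true
  on-edge-top {B = true}  refl = refl
  on-edge-top {B = false} refl = refl

  on-edge-lowest : ∀ {U B k} → B ≡ true → on-edge U B (n + k) k ≡ true
  on-edge-lowest {true}  refl = refl
  on-edge-lowest {false} {k = k} refl = dec-true (n + k ≤? n + k) ≤-refl

  on-edge-climb : ∀ {U B p k} → on-edge U B (suc p) k ≡ true →
                  on-edge U B p k ≡ true ⊎ (U ≡ false × B ≡ true × suc p ≡ n + k)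
  on-edge-climb {true}  {true}          e = inj₁ refl
  on-edge-climb {true}  {false} {p} {k} e =
    inj₁ (dec-true (p ≤? k) (≤-trans (n≤1+n p) (does-true {a? = suc p ≤? k} e)))
  on-edge-climb {false} {true}  {p} {k} e with m≤n⇒m<n∨m≡n (does-true {a? = n + k ≤? suc p} e)
  ... | inj₁ n+k≤p  = inj₁ (dec-true (n + k ≤? p) (≤-pred n+k≤p))
  ... | inj₂ n+k≡p+1 = inj₂ (refl , refl , sym n+k≡p+1)

  on-edge-descend : ∀ {U B p k} → on-edge U B p k ≡ true →
                    on-edge U B (suc p) k ≡ true ⊎ (U ≡ true × B ≡ false × p ≡ k)
  on-edge-descend {true}  {true}          e = inj₁ refl
  on-edge-descend {true}  {false} {p} {k} e with m≤n⇒m<n∨m≡n (does-true {a? = p ≤? k} e)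
  ... | inj₁ p<k = inj₁ (dec-true (suc p ≤? k) p<k)
  ... | inj₂ p≡k = inj₂ (refl , refl , p≡k)
  on-edge-descend {false} {true}  {p} {k} e =
    inj₁ (dec-true (n + k ≤? suc p) (≤-trans (does-true {a? = n + k ≤? p} e) (n≤1+n p)))

  on-edge-meet : ∀ {U B U′ B′ p k k′} → k < n → k′ < n → on-edge U B p k ≡ true → on-edge U′ B′ p k′ ≡ true →
                 (U ≡ true × U′ ≡ true) ⊎ (B ≡ true × B′ ≡ true)
  on-edge-meet {true}  {_}     {true}  {_}                 _   _    _ _ = inj₁ (refl , refl)
  on-edge-meet {_}     {true}  {_}     {true}              _   _    _ _ = inj₂ (refl , refl)
  on-edge-meet {true}  {false} {false} {true} {p} {k} {k′} k<n _ e e′ =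
    ⊥-elim (<⇒≱ (≤-trans k<n (m≤m+n n k′)) (≤-trans (does-true {a? = n + k′ ≤? p} e′) (does-true {a? = p ≤? k} e)))
  on-edge-meet {false} {true}  {true}  {false} {p} {k} {k′} _ k′<n e e′ =
    ⊥-elim (<⇒≱ (≤-trans k′<n (m≤m+n n k)) (≤-trans (does-true {a? = n + k ≤? p} e) (does-true {a? = p ≤? k′} e′)))

  top-vertex : Fin n → Fin m
  top-vertex i = proj₁ (top (S i) (S-subtree i))

  n+i<M : ∀ (i : Fin n) → n + toℕ i < M
  n+i<M i = s≤s (+-monoʳ-≤ n (<⇒≤ (toℕ<n i)))

  top-node : Fin n → Node
  top-node i = sub (V (top-vertex i)) (fromℕ< (n+i<M i))

  member-top-node : ∀ i → member i (top-node i) ≡ true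
  member-top-node i rewrite toℕ-fromℕ< (n+i<M i) =
    on-edge-lowest {memberᵇ i (H (top-vertex i))} (proj₁ (proj₂ (top (S i) (S-subtree i))))

  memberᵇ-upper : ∀ i b → memberᵇ i b ≡ true → member↑ i (above b) ≡ true ⊎ b ≡ V (top-vertex i)
  memberᵇ-upper i (V x) sx with x Fin.≟ top-vertex i
  ... | yes refl = inj₂ refl
  ... | no x≢t with proj₂ (proj₂ (top (S i) (S-subtree i))) x sx x≢t
  ...   | x≢r , spx =
    inj₁ (memberᵇ-H-intro x≢r spx (x≢r , refl) ≤-refl sx)
  memberᵇ-upper i (Z x) e = inj₁ (∧-conicalˡ (S i x) _ e)
  memberᵇ-upper i (H x) e with memberᵇ-H⇒ e
  ... | x≢r , spx , w , (w≢r , pw≡px) , x≤w , sw with above (H x) | hub-above-view x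
  ...   | _ | at-root x≡r = ⊥-elim (x≢r x≡r)
  ...   | _ | after _ (ey , _) with earlier-sibling⇒ ey
  ...     | (y≢r , py≡px) , y<x = inj₁ (memberᵇ-H-intro y≢r (subst (λ z → S i z ≡ true) (sym py≡px) spx)
                                                       (w≢r , trans pw≡px (sym py≡px)) (<⇒≤ (<-≤-trans y<x x≤w)) sw)
  memberᵇ-upper i (H x) e | x≢r , spx , w , w↑ , _ , sw | _ | eldest _ _ =
    inj₁ (∧-intro spx (member-child-from-intro w↑ z≤n sw))
  memberᵇ-upper i (C _) ()
  memberᵇ-upper i (D _) ()

  member-up : ∀ i a → member i a ≡ true → a ≢ top-node i → a ≢ apex × member i (up a) ≡ true
  member-up i (base b) e _ = (λ ()) , subst (λ p → on-edge (member↑ i (above b)) (memberᵇ i b) p (toℕ i) ≡ true)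
                                            (sym (toℕ-fromℕ (n + n))) (on-edge-bottom {member↑ i (above b)} (toℕ<n i) e)
  member-up i (sub b zero) e _ = (λ ()) , trans (member-upper i b) (on-edge-top⇒upper (toℕ<n i) e)
  member-up i (sub b (suc j)) e ≢top with on-edge-climb e
  ... | inj₁ e′ =
    (λ ()) , subst (λ p → on-edge (member↑ i (above b)) (memberᵇ i b) p (toℕ i) ≡ true) (sym (toℕ-inject₁ j)) e′
  ... | inj₂ (U≡false , B≡true , p≡n+i) with memberᵇ-upper i b B≡true
  ...   | inj₁ U≡true = ⊥-elim (Boolₚ.not-¬ U≡true U≡false)
  ...   | inj₂ refl =
    ⊥-elim (≢top (cong (sub (V (top-vertex i))) (toℕ-injective (trans p≡n+i (sym (toℕ-fromℕ< (n+i<M i)))))))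

  image : Fin n → VSet N
  image i = member i ∘ node

  image-subtree : ∀ i → IsSubtree tree (image i)
  image-subtree i = closed⇒subtree (member i) (top-node i) (member-top-node i) (member-up i)

  position : Node → ℕ
  position (sub _ j) = toℕ j
  position _         = 0

  member-has-child : ∀ i b → memberᵇ i b ≡ true → ∃ λ b′ → above b′ ≡ just b
  member-has-child i (V x) _ = Z x , refl
  member-has-child i (Z x) e with member-child-from⇒ {i} {x} {0} (∧-conicalʳ (S i x) _ e)
  ... | y , y↑x , _ with eldest-child y↑x
  ...   | f , f↑x , none = H f , above-eldest f↑x none
  member-has-child i (H x) _ = V x , refl
  member-has-child i (C _) ()
  member-has-child i (D _) ()

  member-below : ∀ i b j → member i (sub b j) ≡ true → toℕ j ≢ toℕ i → member i (below b j) ≡ true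
  member-below i b j e j≢i with n + n ℕ.≟ toℕ j
  ... | yes end = on-edge-bottom⇒lower {member↑ i (above b)} (toℕ<n i)
                    (subst (λ p → on-edge (member↑ i (above b)) (memberᵇ i b) p (toℕ i) ≡ true) (sym end) e)
  ... | no j≢end with on-edge-descend {member↑ i (above b)} e
  ...   | inj₁ e′ = subst (λ p → on-edge (member↑ i (above b)) (memberᵇ i b) p (toℕ i) ≡ true)
                          (cong suc (sym (toℕ-lower₁ j j≢end))) e′
  ...   | inj₂ (_ , _ , j≡i) = ⊥-elim (j≢i j≡i)

  2≤⇒≢1 : ∀ {d} → 2 ≤ d → d ≢ 1
  2≤⇒≢1 (s≤s ()) refl

  image-leaf-position : ∀ i a → member i a ≡ true → degreeIn tree (image i) (code a) ≡ 1 →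
                        position a ≡ toℕ i ⊎ position a ≡ n + toℕ i
  image-leaf-position i (base b) e leaf with member-has-child i b e
  ... | b′ , b′↑b = ⊥-elim (2≤⇒≢1 (2≤degreeIn (member i) {base b} {sub b′ zero} (λ ()) (λ ())
                        (cong (maybe base apex) b′↑b) (proj₂ (member-up i (base b) e (λ ())))
                        (on-edge-top {member↑ i (above b′)} (trans (cong (member↑ i) b′↑b) e))) leaf)
  image-leaf-position i (sub b j) e leaf with toℕ j ℕ.≟ toℕ i | toℕ j ℕ.≟ n + toℕ i
  ... | yes j≡i | _          = inj₁ j≡i
  ... | no _    | yes j≡n+i  = inj₂ j≡n+i
  ... | no j≢i  | no j≢n+i   = ⊥-elim (2≤⇒≢1 (2≤degreeIn (member i) {sub b j} {below b j} (λ ()) (below≢apex b j)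
                                  (up-below b j) (proj₂ (member-up i (sub b j) e not-top)) (member-below i b j e j≢i)) leaf)
    where
    not-top : sub b j ≢ top-node i
    not-top eq = j≢n+i (trans (cong position eq) (toℕ-fromℕ< (n+i<M i)))

  images-leaf-disjoint : ∀ i i′ → i ≢ i′ → ∀ y → ¬ (IsLeafOf tree (image i) y × IsLeafOf tree (image i′) y)
  images-leaf-disjoint i i′ i≢i′ y ((yi , leaf) , (yi′ , leaf′)) with at i yi leaf | at i′ yi′ leaf′
    where
    at : ∀ k → image k y ≡ true → degreeIn tree (image k) y ≡ 1 →
         position (node y) ≡ toℕ k ⊎ position (node y) ≡ n + toℕ k
    at k yk leaf-k =
      image-leaf-position k (node y) yk (subst (λ x → degreeIn tree (image k) x ≡ 1) (sym (code-node y)) leaf-k)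
  ... | inj₁ p≡i    | inj₁ p≡i′    = i≢i′ (toℕ-injective (trans (sym p≡i) p≡i′))
  ... | inj₁ p≡i    | inj₂ p≡n+i′  = <⇒≱ (toℕ<n i) (≤-trans (m≤m+n n (toℕ i′)) (≤-reflexive (trans (sym p≡n+i′) p≡i)))
  ... | inj₂ p≡n+i  | inj₁ p≡i′    = <⇒≱ (toℕ<n i′) (≤-trans (m≤m+n n (toℕ i)) (≤-reflexive (trans (sym p≡n+i) p≡i′)))
  ... | inj₂ p≡n+i  | inj₂ p≡n+i′  = i≢i′ (toℕ-injective (+-cancelˡ-≡ n _ _ (trans (sym p≡n+i) p≡n+i′)))

  common-base : ∀ i i′ b → memberᵇ i b ≡ true → memberᵇ i′ b ≡ true → ∃ λ x → S i x ≡ true × S i′ x ≡ true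
  common-base i i′ (V x) e e′ = x , e , e′
  common-base i i′ (Z x) e e′ = x , ∧-conicalˡ (S i x) _ e , ∧-conicalˡ (S i′ x) _ e′
  common-base i i′ (H x) e e′ = parent x , proj₁ (proj₂ (memberᵇ-H⇒ e)) , proj₁ (proj₂ (memberᵇ-H⇒ e′))
  common-base i i′ (C _) ()
  common-base i i′ (D _) ()

  common-vertex : ∀ i i′ a → member i a ≡ true → member i′ a ≡ true → ∃ λ x → S i x ≡ true × S i′ x ≡ true
  common-vertex i i′ (base b) e e′ = common-base i i′ b e e′
  common-vertex i i′ (sub b j) e e′
    with on-edge-meet {member↑ i (above b)} {memberᵇ i b} {member↑ i′ (above b)} (toℕ<n i) (toℕ<n i′) e e′
  ... | inj₂ (eb , eb′) = common-base i i′ b eb eb′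
  ... | inj₁ (eu , eu′) with above b
  ...   | just b↑ = common-base i i′ b↑ eu eu′

  images-meet⇔ : ∀ i i′ → (∃ λ x → S i x ≡ true × S i′ x ≡ true) ⇔ (∃ λ y → image i y ≡ true × image i′ y ≡ true)
  images-meet⇔ i i′ =
    mk⇔ (λ (x , sx , sx′) → code (base (V x)) , member-code (member i) {base (V x)} sx , member-code (member i′) {base (V x)} sx′)
        (λ (y , e , e′) → common-vertex i i′ (node y) e e′)

-- Rooting T at a leaf leaves room for the extra leaves: the childless vertices and the
-- root are distinct leaves of T.
leaf-root : ∀ {m} (T : Graph m) (T-tree : IsTree T) k → 2 ≤ k → numLeaves T ≤ k →
            Σ (Fin m) λ r → suc (cnt (Rooted.childless T T-tree r)) ≤ k
leaf-root {zero}          T T-tree _ _   _        = ⊥-elim (n≮0 (proj₁ T-tree))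
leaf-root {suc zero}      T T-tree k 2≤k _        = zero , ≤-trans (s≤s (cnt≤size (Rooted.childless T T-tree zero))) 2≤k
leaf-root {suc (suc m)}   T T-tree k 2≤k leaves≤k = r , ≤-trans (Rooted.childless+root≤leaves T T-tree r r-leaf) leaves≤k
  where
  open Rooted T T-tree zero
  r : Fin (suc (suc m))
  r = proj₁ (maximiser depth)
  deepest : ∀ z → depth z ≤ depth r
  deepest = proj₂ (maximiser depth)
  r≢0 : r ≢ zero
  r≢0 r≡0 with () ← depth≡0⇒root {suc zero}
                       (n≤0⇒n≡0 (≤-trans (deepest (suc zero)) (≤-reflexive (trans (cong depth r≡0) depth-root))))
  r-leaf : degree T r ≡ 1
  r-leaf = childless⇒degree≡1 r≢0 (deepest⇒childless deepest)

lemma3p1 : (k : ℕ) → 2 ≤ k → (n : ℕ) (G : Graph n) → Chordal G → LeafageAtMost G k →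
    Σ ℕ λ m → Σ (Graph m) λ T → IsTree T × numLeaves T ≡ k × (∀ x → degree T x ≤ 3) ×
      Σ (SubtreeModel G T) λ M → ∀ i j → i ≢ j → ∀ x →
        ¬ (IsLeafOf T (Sub M i) x × IsLeafOf T (Sub M j) x)
lemma3p1 k 2≤k n G _ (m , T , T-tree , model , leaves≤k) with leaf-root T T-tree k 2≤k leaves≤k
... | r , room = N , tree , isTree , leaves , degree≤3-everywhere , model′ , images-leaf-disjoint
  where
  open Construction T T-tree r (k ∸ suc (cnt (Rooted.childless T T-tree r))) n (Sub model) (subtree model)
  leaves : numLeaves tree ≡ k
  leaves = trans leaf-count (m+[n∸m]≡n room)
  model′ : SubtreeModel G tree
  model′ = record
    { Sub       = image
    ; subtree   = image-subtree
    ; intersect = λ i j i≢j → images-meet⇔ i j ⇔-∘ intersect model i j i≢j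
    }
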